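{- Let $\mathbb{K}$ be a field, $n\ge 1$, and let $\mathcal{E}=\bigwedge\big(\bigoplus_{i=1}^n \mathbb{K}e_i\big)$ be the Grassmann (exterior) algebra with generators $e_1,\dots,e_n$. Let $\mathfrak{X}\subseteq 2^{[n]}$ be any family of subsets of $[n]=\{1,\dots,n\}$, and let $\Im(\mathfrak{X})$ be the two-sided ideal of $\mathcal{E}$ generated by $\{\partial(e_Y): Y\in\mathfrak{X}\}$. Let $X,X'\subseteq[n]$ be subsets with at least two elements each, and let $i_\alpha\in X$. Then: (1) $\partial(e_X)\in\Im(\mathfrak{X})$ if and only if $e_X\in\Im(\mathfrak{X})$. (2) If $e_{X\setminus\{i_\ell\}}\in\Im(\mathfrak{X})$ for every $i_\ell\in X\setminus\{i_\alpha\}$, then $e_{X\setminus\{i_\alpha\}}\in\Im(\mathfrak{X})$. (3) If $X\cap X'=\{i_\alpha\}$, then $e_{X\,\Delta\, X'}\in\Im(\{X,X'\})$, where $\Delta$ denotes symmetric difference and $\Im(\{X,X'\})$ is the two-sided ideal generated by $\partial(e_X)$ and $\partial(e_{X'})$.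
   Context: For a subset $X=\{i_1<\dots<i_m\}\subseteq[n]$, $e_X:=e_{i_1}\wedge\dots\wedge e_{i_m}$, with $e_\emptyset=1$. The map $\partial:\mathcal{E}\to\mathcal{E}$ is the linear map of degree $-1$ determined by $\partial(e_i)=1$ for all $i$ and the Leibniz rule $\partial(a\wedge b)=\partial(a)\wedge b+(-1)^{\deg a}a\wedge\partial(b)$ for homogeneous $a,b$; explicitly, up to an overall sign, $\partial(e_{i_1}\wedge\dots\wedge e_{i_m})=\sum_{j=1}^m(-1)^{j}e_{i_1}\wedge\dots\wedge\widehat{e_{i_j}}\wedge\dots\wedge e_{i_m}$. It satisfies $\partial^2=0$. -}

module Defs where

open import Level using (Level; _⊔_; suc)
open import Data.Nat using (ℕ; zero; suc)
open import Data.Bool using (Bool; true; false; if_then_else_)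
import Data.Bool as Bool
open import Data.Vec using (Vec; []; _∷_)
open import Data.Vec.Properties using (≡-dec)
open import Data.Fin using (Fin)
open import Data.Fin.Subset using (Subset; inside; outside; _⊆_; _∩_; _∪_; _─_; ∣_∣; ⊥)
open import Data.Fin.Subset.Properties using (_⊆?_)
open import Data.Product using (Σ; _×_; ∃)
open import Relation.Nullary using (¬_; Dec; yes; no; _×-dec_)
open import Relation.Binary.PropositionalEquality using (_≡_)
import Data.Nat as ℕ
open import Algebra.Bundles using (CommutativeRing)

record Field (c ℓ : Level) : Set (Level.suc (c ⊔ ℓ)) where
  field
    commutativeRing : CommutativeRing c ℓ
  open CommutativeRing commutativeRing public
  field
    0≉1     : ¬ (0# ≈ 1#)
    inverse : ∀ x → ¬ (x ≈ 0#) → Σ Carrier λ y → x * y ≈ 1#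

_≟ˢ_ : ∀ {n} (X Y : Subset n) → Dec (X ≡ Y)
_≟ˢ_ = ≡-dec Bool._≟_

_Δ_ : ∀ {n} → Subset n → Subset n → Subset n
X Δ Y = (X ─ Y) ∪ (Y ─ X)

-- inv X Y = #{ (x , y) : x ∈ X , y ∈ Y , x > y }  (number of inversions).
inv : ∀ {n} → Subset n → Subset n → ℕ
inv []       []       = 0
inv (x ∷ xs) (y ∷ ys) = (if y then ∣ xs ∣ else 0) ℕ.+ inv xs ys

-- The Grassmann algebra over a field K on generators e_1 … e_n, realised as
-- the free K-module with basis { e_X : X ⊆ [n] }: an element is its coefficient
-- function Subset n → K.
module Grassmann {c ℓ} (K : Field c ℓ) where
  open Field K

  sgn : ℕ → Carrier
  sgn zero    = 1#
  sgn (suc k) = - sgn k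

  ΣS : ∀ {n} → (Subset n → Carrier) → Carrier
  ΣS {zero}  f = f []
  ΣS {suc n} f = ΣS (λ s → f (outside ∷ s)) + ΣS (λ s → f (inside ∷ s))

  𝓔 : ℕ → Set c
  𝓔 n = Subset n → Carrier

  _≈ᴱ_ : ∀ {n} → 𝓔 n → 𝓔 n → Set ℓ
  a ≈ᴱ b = ∀ Z → a Z ≈ b Z

  0ᴱ : ∀ {n} → 𝓔 n
  0ᴱ _ = 0#

  _+ᴱ_ : ∀ {n} → 𝓔 n → 𝓔 n → 𝓔 n
  (a +ᴱ b) Z = a Z + b Z

  e : ∀ {n} → Subset n → 𝓔 n
  e X Z with Z ≟ˢ X
  ... | yes _ = 1#
  ... | no  _ = 0#

  -- e_X ∧ e_Y = (-1)^{inv X Y} e_{X ∪ Y} if X ∩ Y = ∅, and 0 otherwise;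
  -- μ X Y Z is the coefficient of e_Z in e_X ∧ e_Y.
  μ : ∀ {n} → Subset n → Subset n → Subset n → Carrier
  μ X Y Z with (X ∩ Y) ≟ˢ ⊥ | (X ∪ Y) ≟ˢ Z
  ... | yes _ | yes _ = sgn (inv X Y)
  ... | _     | _     = 0#

  _∧_ : ∀ {n} → 𝓔 n → 𝓔 n → 𝓔 n
  (a ∧ b) Z = ΣS λ X → ΣS λ Y → μ X Y Z * (a X * b Y)

  -- coefficient of e_Z in ∂(e_X): if X = Z ∪ {i} with i ∉ Z, it is
  -- (-1)^{#{z ∈ Z : z < i}} = (-1)^{inv {i} Z}, otherwise 0.  This is the map
  -- ∂(e_{i_1} ∧ … ∧ e_{i_m}) = Σ_j (-1)^{j-1} e_{i_1} ∧ … ^{i_j} … ∧ e_{i_m}.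
  δ : ∀ {n} → Subset n → Subset n → Carrier
  δ X Z with Z ⊆? X | ∣ X ─ Z ∣ ℕ.≟ 1
  ... | yes _ | yes _ = sgn (inv (X ─ Z) Z)
  ... | _     | _     = 0#

  ∂ : ∀ {n} → 𝓔 n → 𝓔 n
  ∂ a Z = ΣS λ X → δ X Z * a X

  data Ideal {n} {g} (G : 𝓔 n → Set g) : 𝓔 n → Set (c ⊔ ℓ ⊔ g) where
    gen  : ∀ {x} → G x → Ideal G x
    zer  : Ideal G 0ᴱ
    add  : ∀ {x y} → Ideal G x → Ideal G y → Ideal G (x +ᴱ y)
    mulˡ : ∀ a {x} → Ideal G x → Ideal G (a ∧ x)
    mulʳ : ∀ {x} → Ideal G x → ∀ a → Ideal G (x ∧ a)
    resp : ∀ {x y} → x ≈ᴱ y → Ideal G x → Ideal G y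

  Im : ∀ {n} {p} → (Subset n → Set p) → 𝓔 n → Set (c ⊔ ℓ ⊔ p)
  Im {n} 𝔛 = Ideal (λ x → Σ (Subset n) λ Y → 𝔛 Y × (x ≡ ∂ (e Y)))

{-# OPTIONS --safe #-}

-- Left multiplication by a generator is a contracting homotopy for ∂:
-- ∂ (e_x ∧ a) + e_x ∧ ∂ a = a.  For x ∈ X we have e_x ∧ e_X = 0, hence
-- e_X = e_x ∧ ∂ e_X; together with ∂ Im(𝔛) ⊆ Im(𝔛) (from ∂∂ = 0 and the
-- Leibniz rule) this gives (1).  For (2), write
-- e_{X∖α} = ∂ (e_α ∧ e_{X∖α}) + e_α ∧ ∂ e_{X∖α}: the first term is ± ∂ e_X,
-- and e_X = ± e_ℓ ∧ e_{X∖ℓ} lies in the ideal for any ℓ ∈ X other than α;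
-- the second is a signed sum of the e_α ∧ e_{X∖{α,ℓ}} = ± e_{X∖ℓ}.
-- For (3), e_{XΔX′} = ± e_{X∖α} ∧ e_{X′∖α}, and applying the homotopy formula
-- to both factors, using e_α ∧ w ∧ e_α = 0, gives
-- a ∧ b = ∂ (e_α ∧ a) ∧ b + (e_α ∧ ∂ a) ∧ ∂ (e_α ∧ b), where
-- ∂ (e_α ∧ e_{X∖α}) = ± ∂ e_X.

module Submission where

open import Defs
open import Level using (_⊔_)
open import Function using (id; _∘_; case_of_; _⇔_; mk⇔)
open import Data.Nat as ℕ using (ℕ; zero; suc; _≤_; s≤s)
open import Data.Nat.Properties using (≤-trans; suc-injective)
open import Data.Fin as Fin using (Fin; _≟_)
open import Data.Fin.Subset
  using (Subset; Side; inside; outside; _∈_; _∉_; _⊆_; _∩_; _∪_; _─_; _-_; ⊥; ⁅_⁆; ∣_∣)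
open import Data.Fin.Subset.Properties
  using (_⊆?_; drop-∷-⊆; out⊆; in⊆in; ∉⊥; ∣⊥∣≡0; x∈⁅x⁆; x∈⁅y⁆⇒x≡y; ∣⁅x⁆∣≡1; p⊆q⇒∣p∣≤∣q∣;
         ∩-comm; x∈p∩q⁺; x∈p∩q⁻; nonempty?; p─q⊆p; x∈p∧x≢y⇒x∈p-y; p─x─y≡p─y─x; p─⊥≡p)
open import Data.Vec using (_∷_; []; here; there)
open import Data.Vec.Properties using (∷-injectiveʳ)
open import Data.Product using (∃; _×_; _,_; _,′_; proj₁; proj₂)
open import Data.Sum using (_⊎_; inj₁; inj₂)
open import Data.Bool using (if_then_else_) renaming (_∧_ to _∧ᵇ_; _∨_ to _∨ᵇ_)
open import Data.Empty using (⊥-elim)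
open import Relation.Nullary using (¬_; yes; no; contradiction)
open import Relation.Binary.PropositionalEquality as ≡ using (_≡_; _≢_)
import Relation.Binary.Reasoning.Setoid as SetoidReasoning
open import Algebra.Bundles using (AbelianGroup)
import Algebra.Construct.Pointwise as Pointwise
import Algebra.Properties.AbelianGroup as AbelianGroupProperties
import Algebra.Solver.CommutativeMonoid as CommutativeMonoidSolver

private
  variable
    n : ℕ
    x y : Fin n
    p q X Y Z : Subset n

module _ where

  open ≡ using (refl; sym; trans; cong; cong₂; subst)

  p─p≡⊥ : ∀ (p : Subset n) → p ─ p ≡ ⊥
  p─p≡⊥ []            = refl
  p─p≡⊥ (outside ∷ p) = cong (outside ∷_) (p─p≡⊥ p)
  p─p≡⊥ (inside  ∷ p) = cong (outside ∷_) (p─p≡⊥ p)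

  p⊆q∧∣q─p∣≡0⇒p≡q : p ⊆ q → ∣ q ─ p ∣ ≡ 0 → p ≡ q
  p⊆q∧∣q─p∣≡0⇒p≡q {p = []}          {[]}          _   _  = refl
  p⊆q∧∣q─p∣≡0⇒p≡q {p = outside ∷ p} {outside ∷ q} p⊆q eq =
    cong (outside ∷_) (p⊆q∧∣q─p∣≡0⇒p≡q (drop-∷-⊆ p⊆q) eq)
  p⊆q∧∣q─p∣≡0⇒p≡q {p = inside  ∷ p} {inside  ∷ q} p⊆q eq =
    cong (inside ∷_) (p⊆q∧∣q─p∣≡0⇒p≡q (drop-∷-⊆ p⊆q) eq)
  p⊆q∧∣q─p∣≡0⇒p≡q {p = inside  ∷ p} {outside ∷ q} p⊆q _  with () ← p⊆q here
  p⊆q∧∣q─p∣≡0⇒p≡q {p = outside ∷ p} {inside  ∷ q} _   ()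

  inv-⊥ˡ : ∀ (p : Subset n) → inv ⊥ p ≡ 0
  inv-⊥ˡ []                    = refl
  inv-⊥ˡ (outside ∷ p)         = inv-⊥ˡ p
  inv-⊥ˡ {suc n} (inside ∷ p) = cong₂ ℕ._+_ (∣⊥∣≡0 n) (inv-⊥ˡ p)

  x∈p─q⇒x∉q : x ∈ p ─ q → x ∉ q
  x∈p─q⇒x∉q {p = _ ∷ _} {outside ∷ _} here         ()
  x∈p─q⇒x∉q {p = _ ∷ _} {_ ∷ _}       (there x∈p─q) (there x∈q) = x∈p─q⇒x∉q x∈p─q x∈q

  x∈p-y⇒x≢y : x ∈ p - y → x ≢ y
  x∈p-y⇒x≢y x∈p-x refl = x∈p─q⇒x∉q x∈p-x (x∈⁅x⁆ _)

  ∃-other-element : 2 ≤ ∣ p ∣ → ∀ x → ∃ λ y → y ∈ p × y ≢ x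
  ∃-other-element {p = p} 2≤∣p∣ x with nonempty? (p - x)
  ... | yes (y , y∈p-x) = y , p─q⊆p p ⁅ x ⁆ y∈p-x , x∈p-y⇒x≢y y∈p-x
  ... | no  p-x-empty   =
    contradiction (subst (2 ≤_) (∣⁅x⁆∣≡1 x) (≤-trans 2≤∣p∣ (p⊆q⇒∣p∣≤∣q∣ p⊆⁅x⁆))) λ { (s≤s ()) }
    where
    p⊆⁅x⁆ : p ⊆ ⁅ x ⁆
    p⊆⁅x⁆ {y} y∈p with y ≟ x
    ... | yes refl = x∈⁅x⁆ x
    ... | no  y≢x  = contradiction (y , x∈p∧x≢y⇒x∈p-y y∈p y≢x) p-x-empty

  p∩[q─p]≡⊥ : ∀ (p q : Subset n) → p ∩ (q ─ p) ≡ ⊥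
  p∩[q─p]≡⊥ []            []      = refl
  p∩[q─p]≡⊥ (outside ∷ p) (_ ∷ q) = cong (outside ∷_) (p∩[q─p]≡⊥ p q)
  p∩[q─p]≡⊥ (inside  ∷ p) (_ ∷ q) = cong (outside ∷_) (p∩[q─p]≡⊥ p q)

  p⊆q⇒p∪[q─p]≡q : p ⊆ q → p ∪ (q ─ p) ≡ q
  p⊆q⇒p∪[q─p]≡q {p = []}          {[]}          _   = refl
  p⊆q⇒p∪[q─p]≡q {p = outside ∷ p} {y ∷ q}       p⊆q = cong (y ∷_) (p⊆q⇒p∪[q─p]≡q (drop-∷-⊆ p⊆q))
  p⊆q⇒p∪[q─p]≡q {p = inside  ∷ p} {inside ∷ q}  p⊆q = cong (inside ∷_) (p⊆q⇒p∪[q─p]≡q (drop-∷-⊆ p⊆q))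
  p⊆q⇒p∪[q─p]≡q {p = inside  ∷ p} {outside ∷ q} p⊆q with () ← p⊆q here

  x∈p⇒⁅x⁆⊆p : x ∈ p → ⁅ x ⁆ ⊆ p
  x∈p⇒⁅x⁆⊆p {p = p} x∈p y∈⁅x⁆ = subst (_∈ p) (sym (x∈⁅y⁆⇒x≡y _ y∈⁅x⁆)) x∈p

  p─[p∩q]≡p─q : ∀ (p q : Subset n) → p ─ (p ∩ q) ≡ p ─ q
  p─[p∩q]≡p─q []            []            = refl
  p─[p∩q]≡p─q (outside ∷ p) (outside ∷ q) = cong (outside ∷_) (p─[p∩q]≡p─q p q)
  p─[p∩q]≡p─q (outside ∷ p) (inside  ∷ q) = cong (outside ∷_) (p─[p∩q]≡p─q p q)
  p─[p∩q]≡p─q (inside  ∷ p) (outside ∷ q) = cong (inside ∷_)  (p─[p∩q]≡p─q p q)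
  p─[p∩q]≡p─q (inside  ∷ p) (inside  ∷ q) = cong (outside ∷_) (p─[p∩q]≡p─q p q)

  [p─q]∩[q─p]≡⊥ : ∀ (p q : Subset n) → (p ─ q) ∩ (q ─ p) ≡ ⊥
  [p─q]∩[q─p]≡⊥ []            []            = refl
  [p─q]∩[q─p]≡⊥ (outside ∷ p) (outside ∷ q) = cong (outside ∷_) ([p─q]∩[q─p]≡⊥ p q)
  [p─q]∩[q─p]≡⊥ (outside ∷ p) (inside  ∷ q) = cong (outside ∷_) ([p─q]∩[q─p]≡⊥ p q)
  [p─q]∩[q─p]≡⊥ (inside  ∷ p) (outside ∷ q) = cong (outside ∷_) ([p─q]∩[q─p]≡⊥ p q)
  [p─q]∩[q─p]≡⊥ (inside  ∷ p) (inside  ∷ q) = cong (outside ∷_) ([p─q]∩[q─p]≡⊥ p q)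

  p∩q≡⁅x⁆⇒p-x≡p─q : ∀ (p q : Subset n) → p ∩ q ≡ ⁅ x ⁆ → p - x ≡ p ─ q
  p∩q≡⁅x⁆⇒p-x≡p─q p q eq = trans (cong (p ─_) (sym eq)) (p─[p∩q]≡p─q p q)

module ExteriorAlgebra {c ℓ} (K : Field c ℓ) where

  open Field K hiding (_-_)
  open Grassmann K
  open import Algebra.Properties.Ring ring
    using (-‿distribˡ-*; -‿distribʳ-*; -‿involutive; -1*x≈-x; -0#≈0#; -‿+-comm)
  open import Algebra.Properties.CommutativeSemigroup +-commutativeSemigroup using (interchange)
  open import Algebra.Properties.CommutativeSemigroup *-commutativeSemigroup
    using () renaming (x∙yz≈y∙xz to x*[y*z]≈y*[x*z])
  module ≈-Reasoning = SetoidReasoning setoid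

  -x*-y≈x*y : ∀ x y → - x * - y ≈ x * y
  -x*-y≈x*y x y = begin
    - x * - y    ≈⟨ -‿distribˡ-* x (- y) ⟨
    - (x * - y)  ≈⟨ -‿cong (-‿distribʳ-* x y) ⟨
    - - (x * y)  ≈⟨ -‿involutive (x * y) ⟩
    x * y        ∎
    where open ≈-Reasoning

  sgn-+ : ∀ k m → sgn (k ℕ.+ m) ≈ sgn k * sgn m
  sgn-+ zero    m = sym (*-identityˡ (sgn m))
  sgn-+ (suc k) m = trans (-‿cong (sgn-+ k m)) (-‿distribˡ-* (sgn k) (sgn m))

  sgn*sgn≈1 : ∀ k → sgn k * sgn k ≈ 1#
  sgn*sgn≈1 zero    = *-identityˡ 1#
  sgn*sgn≈1 (suc k) = trans (-x*-y≈x*y (sgn k) (sgn k)) (sgn*sgn≈1 k)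

  ΣS-cong : {f g : Subset n → Carrier} → (∀ X → f X ≈ g X) → ΣS f ≈ ΣS g
  ΣS-cong {zero}  f≈g = f≈g []
  ΣS-cong {suc n} f≈g = +-cong (ΣS-cong (f≈g ∘ (outside ∷_))) (ΣS-cong (f≈g ∘ (inside ∷_)))

  ΣS-zero : {f : Subset n → Carrier} → (∀ X → f X ≈ 0#) → ΣS f ≈ 0#
  ΣS-zero {zero}  f≈0 = f≈0 []
  ΣS-zero {suc n} f≈0 =
    trans (+-cong (ΣS-zero (f≈0 ∘ (outside ∷_))) (ΣS-zero (f≈0 ∘ (inside ∷_)))) (+-identityˡ 0#)

  ΣS-+ : (f g : Subset n → Carrier) → ΣS (λ X → f X + g X) ≈ ΣS f + ΣS g
  ΣS-+ {zero}  f g = refl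
  ΣS-+ {suc n} f g =
    trans (+-cong (ΣS-+ (f ∘ (outside ∷_)) (g ∘ (outside ∷_))) (ΣS-+ (f ∘ (inside ∷_)) (g ∘ (inside ∷_))))
          (interchange _ _ _ _)

  ΣS-homo : (h : Carrier → Carrier) → (∀ {x y} → x ≈ y → h x ≈ h y) → (∀ x y → h (x + y) ≈ h x + h y) →
            (f : Subset n → Carrier) → ΣS (h ∘ f) ≈ h (ΣS f)
  ΣS-homo {zero}  h cong-h +-homo f = refl
  ΣS-homo {suc n} h cong-h +-homo f =
    trans (+-cong (ΣS-homo h cong-h +-homo (f ∘ (outside ∷_))) (ΣS-homo h cong-h +-homo (f ∘ (inside ∷_))))
          (sym (+-homo _ _))

  ΣS-*ˡ : ∀ k (f : Subset n → Carrier) → ΣS (λ X → k * f X) ≈ k * ΣS f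
  ΣS-*ˡ k = ΣS-homo (k *_) *-congˡ (distribˡ k)

  ΣS-neg : (f : Subset n → Carrier) → ΣS (λ X → - f X) ≈ - ΣS f
  ΣS-neg = ΣS-homo -_ -‿cong λ x y → sym (-‿+-comm x y)

  ΣS-single : ∀ Z (f : Subset n → Carrier) → (∀ X → X ≢ Z → f X ≈ 0#) → ΣS f ≈ f Z
  ΣS-single {zero}  []            f f≈0 = refl
  ΣS-single {suc n} (outside ∷ Z) f f≈0 =
    trans (+-cong (ΣS-single Z (f ∘ (outside ∷_)) λ X X≢Z → f≈0 _ (X≢Z ∘ ∷-injectiveʳ))
                  (ΣS-zero λ X → f≈0 (inside ∷ X) (λ ())))
          (+-identityʳ _)
  ΣS-single {suc n} (inside ∷ Z) f f≈0 =
    trans (+-cong (ΣS-zero λ X → f≈0 (outside ∷ X) (λ ()))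
                  (ΣS-single Z (f ∘ (inside ∷_)) λ X X≢Z → f≈0 _ (X≢Z ∘ ∷-injectiveʳ)))
          (+-identityˡ _)

  e-≡ : ∀ (X Z : Subset n) → Z ≡ X → e X Z ≈ 1#
  e-≡ X Z Z≡X with Z ≟ˢ X
  ... | yes _   = refl
  ... | no Z≢X = contradiction Z≡X Z≢X

  e-≢ : ∀ (X Z : Subset n) → Z ≢ X → e X Z ≈ 0#
  e-≢ X Z Z≢X with Z ≟ˢ X
  ... | yes Z≡X = contradiction Z≡X Z≢X
  ... | no _    = refl

  μ-disjoint : ∀ (X Y Z : Subset n) → X ∩ Y ≡ ⊥ → X ∪ Y ≡ Z → μ X Y Z ≈ sgn (inv X Y)
  μ-disjoint X Y Z X∩Y≡⊥ X∪Y≡Z with (X ∩ Y) ≟ˢ ⊥ | (X ∪ Y) ≟ˢ Z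
  ... | yes _     | yes _     = refl
  ... | no X∩Y≢⊥ | _         = contradiction X∩Y≡⊥ X∩Y≢⊥
  ... | yes _     | no X∪Y≢Z = contradiction X∪Y≡Z X∪Y≢Z

  μ-overlap : ∀ (X Y Z : Subset n) → X ∩ Y ≢ ⊥ → μ X Y Z ≈ 0#
  μ-overlap X Y Z X∩Y≢⊥ with (X ∩ Y) ≟ˢ ⊥ | (X ∪ Y) ≟ˢ Z
  ... | yes X∩Y≡⊥ | yes _ = contradiction X∩Y≡⊥ X∩Y≢⊥
  ... | no _      | _     = refl
  ... | yes _     | no _  = refl

  μ-∪≢ : ∀ (X Y Z : Subset n) → X ∪ Y ≢ Z → μ X Y Z ≈ 0#
  μ-∪≢ X Y Z X∪Y≢Z with (X ∩ Y) ≟ˢ ⊥ | (X ∪ Y) ≟ˢ Z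
  ... | yes _ | yes X∪Y≡Z = contradiction X∪Y≡Z X∪Y≢Z
  ... | no _  | _         = refl
  ... | yes _ | no _      = refl

  δ-facet : ∀ (X Z : Subset n) → Z ⊆ X → ∣ X ─ Z ∣ ≡ 1 → δ X Z ≈ sgn (inv (X ─ Z) Z)
  δ-facet X Z Z⊆X ∣X─Z∣≡1 with Z ⊆? X | ∣ X ─ Z ∣ ℕ.≟ 1
  ... | yes _   | yes _ = refl
  ... | no Z⊈X | _     = ⊥-elim (Z⊈X Z⊆X)
  ... | yes _   | no ≢1 = contradiction ∣X─Z∣≡1 ≢1

  δ-⊈ : ∀ (X Z : Subset n) → ¬ Z ⊆ X → δ X Z ≈ 0#
  δ-⊈ X Z Z⊈X with Z ⊆? X | ∣ X ─ Z ∣ ℕ.≟ 1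
  ... | yes Z⊆X | yes _ = ⊥-elim (Z⊈X Z⊆X)
  ... | no _    | _     = refl
  ... | yes _   | no _  = refl

  δ-∣─∣≢1 : ∀ (X Z : Subset n) → ∣ X ─ Z ∣ ≢ 1 → δ X Z ≈ 0#
  δ-∣─∣≢1 X Z ≢1 with Z ⊆? X | ∣ X ─ Z ∣ ℕ.≟ 1
  ... | yes _ | yes ≡1 = contradiction ≡1 ≢1
  ... | no _  | _      = refl
  ... | yes _ | no _   = refl

  e-cong : X ≡ Y → e X ≈ᴱ e Y
  e-cong ≡.refl Z = refl

  e-∷ : ∀ b (X Z : Subset n) → e (b ∷ X) (b ∷ Z) ≈ e X Z
  e-∷ b X Z = case Z ≟ˢ X of λ where
    (yes Z≡X) → trans (e-≡ (b ∷ X) (b ∷ Z) (≡.cong (b ∷_) Z≡X)) (sym (e-≡ X Z Z≡X))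
    (no Z≢X)  → trans (e-≢ (b ∷ X) (b ∷ Z) (Z≢X ∘ ∷-injectiveʳ)) (sym (e-≢ X Z Z≢X))

  -- The contribution of the first generator to μ; the sign (-1)^∣X∣ comes from moving it,
  -- when it lies in the right factor, past the generators of X.
  μ-head : Side → Side → Side → ℕ → Carrier
  μ-head outside outside outside _ = 1#
  μ-head outside inside  inside  k = sgn k
  μ-head inside  outside inside  _ = 1#
  μ-head _       _       _       _ = 0#

  μ-∷ : ∀ x y z (X Y Z : Subset n) → μ (x ∷ X) (y ∷ Y) (z ∷ Z) ≈ μ-head x y z ∣ X ∣ * μ X Y Z
  μ-∷ x y z X Y Z = case (X ∩ Y) ≟ˢ ⊥ ,′ (X ∪ Y) ≟ˢ Z of λ where
      (no X∩Y≢⊥ , _) →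
        both-vanish (μ-overlap (x ∷ X) (y ∷ Y) (z ∷ Z) (X∩Y≢⊥ ∘ ∷-injectiveʳ)) (μ-overlap X Y Z X∩Y≢⊥)
      (yes _ , no X∪Y≢Z) →
        both-vanish (μ-∪≢ (x ∷ X) (y ∷ Y) (z ∷ Z) (X∪Y≢Z ∘ ∷-injectiveʳ)) (μ-∪≢ X Y Z X∪Y≢Z)
      (yes X∩Y≡⊥ , yes X∪Y≡Z) → heads X∩Y≡⊥ X∪Y≡Z x y z
    where
    both-vanish : μ (x ∷ X) (y ∷ Y) (z ∷ Z) ≈ 0# → μ X Y Z ≈ 0# →
                  μ (x ∷ X) (y ∷ Y) (z ∷ Z) ≈ μ-head x y z ∣ X ∣ * μ X Y Z
    both-vanish μ∷≈0 μ≈0 = trans μ∷≈0 (sym (trans (*-congˡ μ≈0) (zeroʳ _)))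
    head-vanishes : ∀ x y z → μ (x ∷ X) (y ∷ Y) (z ∷ Z) ≈ 0# → μ (x ∷ X) (y ∷ Y) (z ∷ Z) ≈ 0# * μ X Y Z
    head-vanishes _ _ _ μ∷≈0 = trans μ∷≈0 (sym (zeroˡ _))
    disjoint-heads : ∀ x y z → X ∩ Y ≡ ⊥ → X ∪ Y ≡ Z → x ∧ᵇ y ≡ outside → x ∨ᵇ y ≡ z →
                     μ (x ∷ X) (y ∷ Y) (z ∷ Z) ≈ sgn (if y then ∣ X ∣ else 0) * μ X Y Z
    disjoint-heads x y z X∩Y≡⊥ X∪Y≡Z ∩≡ ∪≡ =
      trans (μ-disjoint (x ∷ X) (y ∷ Y) (z ∷ Z) (≡.cong₂ _∷_ ∩≡ X∩Y≡⊥) (≡.cong₂ _∷_ ∪≡ X∪Y≡Z))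
            (trans (sgn-+ (if y then ∣ X ∣ else 0) (inv X Y)) (*-congˡ (sym (μ-disjoint X Y Z X∩Y≡⊥ X∪Y≡Z))))
    heads : X ∩ Y ≡ ⊥ → X ∪ Y ≡ Z → ∀ x y z → μ (x ∷ X) (y ∷ Y) (z ∷ Z) ≈ μ-head x y z ∣ X ∣ * μ X Y Z
    heads d u outside outside outside = disjoint-heads outside outside outside d u ≡.refl ≡.refl
    heads d u outside inside  inside  = disjoint-heads outside inside  inside  d u ≡.refl ≡.refl
    heads d u inside  outside inside  = disjoint-heads inside  outside inside  d u ≡.refl ≡.refl
    heads d u outside outside inside  =
      head-vanishes outside outside inside (μ-∪≢ (outside ∷ X) (outside ∷ Y) (inside ∷ Z) λ ())
    heads d u outside inside  outside =
      head-vanishes outside inside outside (μ-∪≢ (outside ∷ X) (inside ∷ Y) (outside ∷ Z) λ ())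
    heads d u inside  outside outside =
      head-vanishes inside outside outside (μ-∪≢ (inside ∷ X) (outside ∷ Y) (outside ∷ Z) λ ())
    heads d u inside  inside  z       =
      head-vanishes inside inside z (μ-overlap (inside ∷ X) (inside ∷ Y) (z ∷ Z) λ ())

  δ-out-out : ∀ (X Z : Subset n) → δ (outside ∷ X) (outside ∷ Z) ≈ δ X Z
  δ-out-out X Z = case (Z ⊆? X) ,′ (∣ X ─ Z ∣ ℕ.≟ 1) of λ where
      (yes Z⊆X , yes ≡1) →
        trans (δ-facet (outside ∷ X) (outside ∷ Z) (out⊆ Z⊆X) ≡1) (sym (δ-facet X Z Z⊆X ≡1))
      (no Z⊈X  , _)      →
        trans (δ-⊈ (outside ∷ X) (outside ∷ Z) (Z⊈X ∘ drop-∷-⊆)) (sym (δ-⊈ X Z Z⊈X))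
      (yes _   , no ≢1)  →
        trans (δ-∣─∣≢1 (outside ∷ X) (outside ∷ Z) ≢1) (sym (δ-∣─∣≢1 X Z ≢1))

  δ-out-in : ∀ (X Z : Subset n) → δ (outside ∷ X) (inside ∷ Z) ≈ 0#
  δ-out-in X Z = δ-⊈ (outside ∷ X) (inside ∷ Z) λ Z⊆X → case Z⊆X here of λ ()

  δ-in-out : ∀ (X Z : Subset n) → δ (inside ∷ X) (outside ∷ Z) ≈ e X Z
  δ-in-out {n} X Z = case Z ≟ˢ X ,′ (Z ⊆? X) of λ where
      (yes ≡.refl , _)   → diagonal
      (no Z≢X , no Z⊈X)  →
        trans (δ-⊈ (inside ∷ X) (outside ∷ Z) (Z⊈X ∘ drop-∷-⊆)) (sym (e-≢ X Z Z≢X))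
      (no Z≢X , yes Z⊆X) →
        trans (δ-∣─∣≢1 (inside ∷ X) (outside ∷ Z) (Z≢X ∘ p⊆q∧∣q─p∣≡0⇒p≡q Z⊆X ∘ suc-injective))
              (sym (e-≢ X Z Z≢X))
    where
    diagonal : δ (inside ∷ X) (outside ∷ X) ≈ e X X
    diagonal = begin
      δ (inside ∷ X) (outside ∷ X)
        ≈⟨ δ-facet (inside ∷ X) (outside ∷ X) (out⊆ id) (≡.cong suc (≡.trans (≡.cong ∣_∣ (p─p≡⊥ X)) (∣⊥∣≡0 n))) ⟩
      sgn (inv (inside ∷ (X ─ X)) (outside ∷ X))
        ≡⟨ ≡.cong sgn (≡.trans (≡.cong (λ W → inv W X) (p─p≡⊥ X)) (inv-⊥ˡ X)) ⟩
      1#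
        ≈⟨ e-≡ X X ≡.refl ⟨
      e X X
        ∎
      where open ≈-Reasoning

  δ-in-in : ∀ (X Z : Subset n) → δ (inside ∷ X) (inside ∷ Z) ≈ - δ X Z
  δ-in-in X Z = case (Z ⊆? X) ,′ (∣ X ─ Z ∣ ℕ.≟ 1) of λ where
      (yes Z⊆X , yes ≡1) → trans (δ-facet (inside ∷ X) (inside ∷ Z) (in⊆in Z⊆X) ≡1)
                                  (trans (reflexive (≡.cong (λ k → sgn (k ℕ.+ inv (X ─ Z) Z)) ≡1))
                                         (-‿cong (sym (δ-facet X Z Z⊆X ≡1))))
      (no Z⊈X  , _)     →
        trans (δ-⊈ (inside ∷ X) (inside ∷ Z) (Z⊈X ∘ drop-∷-⊆)) (sym (trans (-‿cong (δ-⊈ X Z Z⊈X)) -0#≈0#))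
      (yes _   , no ≢1) →
        trans (δ-∣─∣≢1 (inside ∷ X) (inside ∷ Z) ≢1) (sym (trans (-‿cong (δ-∣─∣≢1 X Z ≢1)) -0#≈0#))

  module 𝓔+ {n : ℕ} = AbelianGroup (Pointwise.abelianGroup (Subset n) +-abelianGroup)
  module 𝓔+-Properties {n : ℕ} = AbelianGroupProperties (Pointwise.abelianGroup (Subset n) +-abelianGroup)
  module ≈ᴱ-Reasoning {n : ℕ} = SetoidReasoning (𝓔+.setoid {n})

  -ᴱ_ : 𝓔 n → 𝓔 n
  (-ᴱ a) Z = - a Z

  _·ᴱ_ : Carrier → 𝓔 n → 𝓔 n
  (k ·ᴱ a) Z = k * a Z

  1ᴱ : 𝓔 n
  1ᴱ = e ⊥

  -- The grade involution e_Z ↦ (-1)^∣Z∣ e_Z: the Leibniz rule for inhomogeneous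
  -- elements reads ∂ (a ∧ b) = ∂ a ∧ b + hat a ∧ ∂ b.
  hat : 𝓔 n → 𝓔 n
  hat a Z = sgn ∣ Z ∣ * a Z

  -- a = lo a + e₀ ∧ hi a, where lo a and hi a do not involve the first generator e₀.
  lo hi : 𝓔 (suc n) → 𝓔 n
  lo a Z = a (outside ∷ Z)
  hi a Z = a (inside ∷ Z)

  private
    variable
      a a′ b b′ : 𝓔 n

  lo-hi-ext : lo a ≈ᴱ lo b → hi a ≈ᴱ hi b → a ≈ᴱ b
  lo-hi-ext lo≈ hi≈ (outside ∷ Z) = lo≈ Z
  lo-hi-ext lo≈ hi≈ (inside  ∷ Z) = hi≈ Z

  []-ext : {a b : 𝓔 0} → a [] ≈ b [] → a ≈ᴱ b
  []-ext a≈b [] = a≈b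

  +ᴱ-cong : a ≈ᴱ a′ → b ≈ᴱ b′ → (a +ᴱ b) ≈ᴱ (a′ +ᴱ b′)
  +ᴱ-cong a≈ b≈ Z = +-cong (a≈ Z) (b≈ Z)

  -ᴱ-cong : a ≈ᴱ a′ → (-ᴱ a) ≈ᴱ (-ᴱ a′)
  -ᴱ-cong a≈ Z = -‿cong (a≈ Z)

  ·ᴱ-congˡ : ∀ k → a ≈ᴱ a′ → (k ·ᴱ a) ≈ᴱ (k ·ᴱ a′)
  ·ᴱ-congˡ k a≈ Z = *-congˡ (a≈ Z)

  hat-cong : a ≈ᴱ a′ → hat a ≈ᴱ hat a′
  hat-cong a≈ Z = *-congˡ (a≈ Z)

  ∧-cong : a ≈ᴱ a′ → b ≈ᴱ b′ → (a ∧ b) ≈ᴱ (a′ ∧ b′)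
  ∧-cong a≈ b≈ Z = ΣS-cong λ X → ΣS-cong λ Y → *-congˡ (*-cong (a≈ X) (b≈ Y))

  ∂-cong : a ≈ᴱ a′ → ∂ a ≈ᴱ ∂ a′
  ∂-cong a≈ Z = ΣS-cong λ X → *-congˡ (a≈ X)

  -ᴱ≈-1·ᴱ : ∀ (a : 𝓔 n) → (-ᴱ a) ≈ᴱ ((- 1#) ·ᴱ a)
  -ᴱ≈-1·ᴱ a Z = sym (-1*x≈-x (a Z))

  ·ᴱ-sgn-involutive : ∀ k (a : 𝓔 n) → (sgn k ·ᴱ (sgn k ·ᴱ a)) ≈ᴱ a
  ·ᴱ-sgn-involutive k a Z = trans (sym (*-assoc _ _ _)) (trans (*-congʳ (sgn*sgn≈1 k)) (*-identityˡ (a Z)))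

  ΣΣ-+ : (f g : Subset n → Subset n → Carrier) →
         ΣS (λ X → ΣS (λ Y → f X Y + g X Y)) ≈ ΣS (λ X → ΣS (f X)) + ΣS (λ X → ΣS (g X))
  ΣΣ-+ f g = trans (ΣS-cong λ X → ΣS-+ (f X) (g X)) (ΣS-+ (λ X → ΣS (f X)) (λ X → ΣS (g X)))

  ΣΣ-*ˡ : ∀ k (f : Subset n → Subset n → Carrier) →
          ΣS (λ X → ΣS (λ Y → k * f X Y)) ≈ k * ΣS (λ X → ΣS (f X))
  ΣΣ-*ˡ k f = trans (ΣS-cong λ X → ΣS-*ˡ k (f X)) (ΣS-*ˡ k (λ X → ΣS (f X)))

  ∧-distribʳ-+ : ∀ (d a b : 𝓔 n) → ((a +ᴱ b) ∧ d) ≈ᴱ ((a ∧ d) +ᴱ (b ∧ d))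
  ∧-distribʳ-+ d a b Z =
    trans (ΣS-cong λ X → ΣS-cong λ Y → trans (*-congˡ (distribʳ (d Y) (a X) (b X))) (distribˡ _ _ _))
          (ΣΣ-+ (λ X Y → μ X Y Z * (a X * d Y)) (λ X Y → μ X Y Z * (b X * d Y)))

  ∧-distribˡ-+ : ∀ (a b d : 𝓔 n) → (a ∧ (b +ᴱ d)) ≈ᴱ ((a ∧ b) +ᴱ (a ∧ d))
  ∧-distribˡ-+ a b d Z =
    trans (ΣS-cong λ X → ΣS-cong λ Y → trans (*-congˡ (distribˡ (a X) (b Y) (d Y))) (distribˡ _ _ _))
          (ΣΣ-+ (λ X Y → μ X Y Z * (a X * b Y)) (λ X Y → μ X Y Z * (a X * d Y)))

  ∧-·ˡ : ∀ k (a b : 𝓔 n) → ((k ·ᴱ a) ∧ b) ≈ᴱ (k ·ᴱ (a ∧ b))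
  ∧-·ˡ k a b Z =
    trans (ΣS-cong λ X → ΣS-cong λ Y → trans (*-congˡ (*-assoc k (a X) (b Y))) (x*[y*z]≈y*[x*z] _ k _))
          (ΣΣ-*ˡ k λ X Y → μ X Y Z * (a X * b Y))

  ∧-·ʳ : ∀ k (a b : 𝓔 n) → (a ∧ (k ·ᴱ b)) ≈ᴱ (k ·ᴱ (a ∧ b))
  ∧-·ʳ k a b Z =
    trans (ΣS-cong λ X → ΣS-cong λ Y → trans (*-congˡ (x*[y*z]≈y*[x*z] (a X) k (b Y))) (x*[y*z]≈y*[x*z] _ k _))
          (ΣΣ-*ˡ k λ X Y → μ X Y Z * (a X * b Y))

  ∧-negˡ : ∀ (a b : 𝓔 n) → ((-ᴱ a) ∧ b) ≈ᴱ (-ᴱ (a ∧ b))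
  ∧-negˡ a b = begin
    (-ᴱ a) ∧ b          ≈⟨ ∧-cong (-ᴱ≈-1·ᴱ a) 𝓔+.refl ⟩
    ((- 1#) ·ᴱ a) ∧ b   ≈⟨ ∧-·ˡ (- 1#) a b ⟩
    (- 1#) ·ᴱ (a ∧ b)   ≈⟨ -ᴱ≈-1·ᴱ (a ∧ b) ⟨
    -ᴱ (a ∧ b)          ∎
    where open ≈ᴱ-Reasoning

  ∧-negʳ : ∀ (a b : 𝓔 n) → (a ∧ (-ᴱ b)) ≈ᴱ (-ᴱ (a ∧ b))
  ∧-negʳ a b = begin
    a ∧ (-ᴱ b)          ≈⟨ ∧-cong 𝓔+.refl (-ᴱ≈-1·ᴱ b) ⟩
    a ∧ ((- 1#) ·ᴱ b)   ≈⟨ ∧-·ʳ (- 1#) a b ⟩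
    (- 1#) ·ᴱ (a ∧ b)   ≈⟨ -ᴱ≈-1·ᴱ (a ∧ b) ⟨
    -ᴱ (a ∧ b)          ∎
    where open ≈ᴱ-Reasoning

  ∧-zeroˡ : ∀ (b : 𝓔 n) → (0ᴱ ∧ b) ≈ᴱ 0ᴱ
  ∧-zeroˡ b Z = ΣS-zero λ X → ΣS-zero λ Y → trans (*-congˡ (zeroˡ (b Y))) (zeroʳ (μ X Y Z))

  ∧-zeroʳ : ∀ (a : 𝓔 n) → (a ∧ 0ᴱ) ≈ᴱ 0ᴱ
  ∧-zeroʳ a Z = ΣS-zero λ X → ΣS-zero λ Y → trans (*-congˡ (zeroʳ (a X))) (zeroʳ (μ X Y Z))

  ∂-+ : ∀ (a b : 𝓔 n) → ∂ (a +ᴱ b) ≈ᴱ (∂ a +ᴱ ∂ b)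
  ∂-+ a b Z =
    trans (ΣS-cong λ X → distribˡ (δ X Z) (a X) (b X)) (ΣS-+ (λ X → δ X Z * a X) (λ X → δ X Z * b X))

  ∂-· : ∀ k (a : 𝓔 n) → ∂ (k ·ᴱ a) ≈ᴱ (k ·ᴱ ∂ a)
  ∂-· k a Z = trans (ΣS-cong λ X → x*[y*z]≈y*[x*z] (δ X Z) k (a X)) (ΣS-*ˡ k λ X → δ X Z * a X)

  ∂-neg : ∀ (a : 𝓔 n) → ∂ (-ᴱ a) ≈ᴱ (-ᴱ ∂ a)
  ∂-neg a Z = trans (ΣS-cong λ X → sym (-‿distribʳ-* (δ X Z) (a X))) (ΣS-neg λ X → δ X Z * a X)

  ∂-zero : ∂ {n} 0ᴱ ≈ᴱ 0ᴱ
  ∂-zero Z = ΣS-zero λ X → zeroʳ (δ X Z)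

  hat-+ : ∀ (a b : 𝓔 n) → hat (a +ᴱ b) ≈ᴱ (hat a +ᴱ hat b)
  hat-+ a b Z = distribˡ _ (a Z) (b Z)

  hat-neg : ∀ (a : 𝓔 n) → hat (-ᴱ a) ≈ᴱ (-ᴱ hat a)
  hat-neg a Z = sym (-‿distribʳ-* _ (a Z))

  hat-zero : hat {n} 0ᴱ ≈ᴱ 0ᴱ
  hat-zero Z = zeroʳ _

  ∧-part : 𝓔 (suc n) → 𝓔 (suc n) → Side → Subset n → Side → Side → Carrier
  ∧-part a b z Z x y = ΣS λ X → ΣS λ Y → μ-head x y z ∣ X ∣ * (μ X Y Z * (a (x ∷ X) * b (y ∷ Y)))

  ∧-∷ : ∀ (a b : 𝓔 (suc n)) z Z →
        (a ∧ b) (z ∷ Z) ≈ (∧-part a b z Z outside outside + ∧-part a b z Z outside inside)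
                        + (∧-part a b z Z inside  outside + ∧-part a b z Z inside  inside)
  ∧-∷ a b z Z = +-cong (split outside) (split inside)
    where
    term : Side → Side → Subset _ → Subset _ → Carrier
    term x y X Y = μ (x ∷ X) (y ∷ Y) (z ∷ Z) * (a (x ∷ X) * b (y ∷ Y))
    head : ∀ x y → ΣS (λ X → ΣS (term x y X)) ≈ ∧-part a b z Z x y
    head x y = ΣS-cong λ X → ΣS-cong λ Y → trans (*-congʳ (μ-∷ x y z X Y Z)) (*-assoc _ _ _)
    split : ∀ x → ΣS (λ X → ΣS (term x outside X) + ΣS (term x inside X)) ≈
                  ∧-part a b z Z x outside + ∧-part a b z Z x inside
    split x = trans (ΣS-+ (λ X → ΣS (term x outside X)) (λ X → ΣS (term x inside X)))
                    (+-cong (head x outside) (head x inside))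

  ∧-part-vanishes : ∀ (a b : 𝓔 (suc n)) Z x y →
                    ΣS (λ X → ΣS λ Y → 0# * (μ X Y Z * (a (x ∷ X) * b (y ∷ Y)))) ≈ 0#
  ∧-part-vanishes a b Z x y = ΣS-zero λ X → ΣS-zero λ Y → zeroˡ (μ X Y Z * (a (x ∷ X) * b (y ∷ Y)))

  lo-∧ : ∀ (a b : 𝓔 (suc n)) → lo (a ∧ b) ≈ᴱ (lo a ∧ lo b)
  lo-∧ a b Z = begin
    (a ∧ b) (outside ∷ Z)
      ≈⟨ ∧-∷ a b outside Z ⟩
    (∧-part a b outside Z outside outside + ∧-part a b outside Z outside inside)
      + (∧-part a b outside Z inside outside + ∧-part a b outside Z inside inside)
      ≈⟨ +-cong (+-cong survivor (∧-part-vanishes a b Z outside inside))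
                (+-cong (∧-part-vanishes a b Z inside outside) (∧-part-vanishes a b Z inside inside)) ⟩
    ((lo a ∧ lo b) Z + 0#) + (0# + 0#)
      ≈⟨ trans (+-cong (+-identityʳ _) (+-identityʳ 0#)) (+-identityʳ _) ⟩
    (lo a ∧ lo b) Z
      ∎
    where
    open ≈-Reasoning
    survivor : ∧-part a b outside Z outside outside ≈ (lo a ∧ lo b) Z
    survivor = ΣS-cong λ X → ΣS-cong λ Y → *-identityˡ (μ X Y Z * (lo a X * lo b Y))

  hi-∧ : ∀ (a b : 𝓔 (suc n)) → hi (a ∧ b) ≈ᴱ ((hi a ∧ lo b) +ᴱ (hat (lo a) ∧ hi b))
  hi-∧ a b Z = begin
    (a ∧ b) (inside ∷ Z)
      ≈⟨ ∧-∷ a b inside Z ⟩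
    (∧-part a b inside Z outside outside + ∧-part a b inside Z outside inside)
      + (∧-part a b inside Z inside outside + ∧-part a b inside Z inside inside)
      ≈⟨ +-cong (+-cong (∧-part-vanishes a b Z outside outside) survivorᵣ)
                (+-cong survivorₗ (∧-part-vanishes a b Z inside inside)) ⟩
    (0# + (hat (lo a) ∧ hi b) Z) + ((hi a ∧ lo b) Z + 0#)
      ≈⟨ trans (+-cong (+-identityˡ _) (+-identityʳ _)) (+-comm _ _) ⟩
    (hi a ∧ lo b) Z + (hat (lo a) ∧ hi b) Z
      ∎
    where
    open ≈-Reasoning
    survivorₗ : ∧-part a b inside Z inside outside ≈ (hi a ∧ lo b) Z
    survivorₗ = ΣS-cong λ X → ΣS-cong λ Y → *-identityˡ (μ X Y Z * (hi a X * lo b Y))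
    survivorᵣ : ∧-part a b inside Z outside inside ≈ (hat (lo a) ∧ hi b) Z
    survivorᵣ = ΣS-cong λ X → ΣS-cong λ Y →
      trans (x*[y*z]≈y*[x*z] (sgn ∣ X ∣) (μ X Y Z) _) (*-congˡ (sym (*-assoc (sgn ∣ X ∣) (lo a X) (hi b Y))))

  lo-∂ : ∀ (a : 𝓔 (suc n)) → lo (∂ a) ≈ᴱ (∂ (lo a) +ᴱ hi a)
  lo-∂ a Z = +-cong (ΣS-cong λ X → *-congʳ (δ-out-out X Z)) (begin
    ΣS (λ X → δ (inside ∷ X) (outside ∷ Z) * hi a X)  ≈⟨ ΣS-cong (λ X → *-congʳ (δ-in-out X Z)) ⟩
    ΣS (λ X → e X Z * hi a X)                         ≈⟨ ΣS-single Z _ (λ X X≢Z →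
                                                           trans (*-congʳ (e-≢ X Z (X≢Z ∘ ≡.sym))) (zeroˡ _)) ⟩
    e Z Z * hi a Z                                    ≈⟨ *-congʳ (e-≡ Z Z ≡.refl) ⟩
    1# * hi a Z                                       ≈⟨ *-identityˡ _ ⟩
    hi a Z                                            ∎)
    where open ≈-Reasoning

  hi-∂ : ∀ (a : 𝓔 (suc n)) → hi (∂ a) ≈ᴱ (-ᴱ ∂ (hi a))
  hi-∂ a Z = begin
    ΣS (λ X → δ (outside ∷ X) (inside ∷ Z) * lo a X) + ΣS (λ X → δ (inside ∷ X) (inside ∷ Z) * hi a X)
      ≈⟨ +-cong (ΣS-zero λ X → trans (*-congʳ (δ-out-in X Z)) (zeroˡ _))
                (ΣS-cong λ X → trans (*-congʳ (δ-in-in X Z)) (sym (-‿distribˡ-* _ _))) ⟩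
    0# + ΣS (λ X → - (δ X Z * hi a X))    ≈⟨ +-identityˡ _ ⟩
    ΣS (λ X → - (δ X Z * hi a X))         ≈⟨ ΣS-neg (λ X → δ X Z * hi a X) ⟩
    - ∂ (hi a) Z                          ∎
    where open ≈-Reasoning

  hi-hat : ∀ (a : 𝓔 (suc n)) → hi (hat a) ≈ᴱ (-ᴱ hat (hi a))
  hi-hat a Z = sym (-‿distribˡ-* _ (hi a Z))

  ∧-[] : ∀ (a b : 𝓔 0) → (a ∧ b) [] ≈ a [] * b []
  ∧-[] a b = trans (*-congʳ (μ-disjoint [] [] [] ≡.refl ≡.refl)) (*-identityˡ _)

  ∂-[] : ∀ (a : 𝓔 0) → ∂ a [] ≈ 0#
  ∂-[] a = trans (*-congʳ (δ-∣─∣≢1 [] [] λ ())) (zeroˡ _)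

  lo-e-outside : ∀ (X : Subset n) → lo (e (outside ∷ X)) ≈ᴱ e X
  lo-e-outside X = e-∷ outside X

  hi-e-outside : ∀ (X : Subset n) → hi (e (outside ∷ X)) ≈ᴱ 0ᴱ
  hi-e-outside X Z = e-≢ (outside ∷ X) (inside ∷ Z) λ ()

  lo-e-inside : ∀ (X : Subset n) → lo (e (inside ∷ X)) ≈ᴱ 0ᴱ
  lo-e-inside X Z = e-≢ (inside ∷ X) (outside ∷ Z) λ ()

  hi-e-inside : ∀ (X : Subset n) → hi (e (inside ∷ X)) ≈ᴱ e X
  hi-e-inside X = e-∷ inside X

  hat-e : ∀ (U : Subset n) → hat (e U) ≈ᴱ (sgn ∣ U ∣ ·ᴱ e U)
  hat-e U Z with Z ≟ˢ U
  ... | yes ≡.refl = refl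
  ... | no _       = trans (zeroʳ _) (sym (zeroʳ _))

  hat-1ᴱ : hat {n} 1ᴱ ≈ᴱ 1ᴱ
  hat-1ᴱ {n} Z = trans (hat-e ⊥ Z) (trans (*-congʳ (reflexive (≡.cong sgn (∣⊥∣≡0 n)))) (*-identityˡ _))

  ∧-identityˡ : ∀ (a : 𝓔 n) → (1ᴱ ∧ a) ≈ᴱ a
  ∧-identityˡ {zero}  a = []-ext (trans (∧-[] 1ᴱ a) (trans (*-congʳ (e-≡ ⊥ [] ≡.refl)) (*-identityˡ _)))
  ∧-identityˡ {suc n} a = lo-hi-ext
    (begin
      lo (1ᴱ ∧ a)      ≈⟨ lo-∧ 1ᴱ a ⟩
      lo 1ᴱ ∧ lo a     ≈⟨ ∧-cong (lo-e-outside ⊥) 𝓔+.refl ⟩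
      1ᴱ ∧ lo a        ≈⟨ ∧-identityˡ (lo a) ⟩
      lo a             ∎)
    (begin
      hi (1ᴱ ∧ a)                            ≈⟨ hi-∧ 1ᴱ a ⟩
      (hi 1ᴱ ∧ lo a) +ᴱ (hat (lo 1ᴱ) ∧ hi a) ≈⟨ +ᴱ-cong (∧-cong (hi-e-outside ⊥) 𝓔+.refl)
                                                       (∧-cong (𝓔+.trans (hat-cong (lo-e-outside ⊥)) hat-1ᴱ) 𝓔+.refl) ⟩
      (0ᴱ ∧ lo a) +ᴱ (1ᴱ ∧ hi a)             ≈⟨ +ᴱ-cong (∧-zeroˡ (lo a)) (∧-identityˡ (hi a)) ⟩
      0ᴱ +ᴱ hi a                             ≈⟨ 𝓔+.identityˡ (hi a) ⟩
      hi a                                   ∎)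
    where open ≈ᴱ-Reasoning

  hat-∧ : ∀ (a b : 𝓔 n) → hat (a ∧ b) ≈ᴱ (hat a ∧ hat b)
  hat-∧ {zero}  a b = []-ext (trans (*-identityˡ _) (trans (∧-[] a b)
                        (sym (trans (∧-[] (hat a) (hat b)) (*-cong (*-identityˡ _) (*-identityˡ _))))))
  hat-∧ {suc n} a b = lo-hi-ext
    (begin
      hat (lo (a ∧ b))         ≈⟨ hat-cong (lo-∧ a b) ⟩
      hat (lo a ∧ lo b)        ≈⟨ hat-∧ (lo a) (lo b) ⟩
      hat (lo a) ∧ hat (lo b)  ≈⟨ lo-∧ (hat a) (hat b) ⟨
      lo (hat a ∧ hat b)       ∎)
    (begin
      hi (hat (a ∧ b))
        ≈⟨ hi-hat (a ∧ b) ⟩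
      -ᴱ hat (hi (a ∧ b))
        ≈⟨ -ᴱ-cong (hat-cong (hi-∧ a b)) ⟩
      -ᴱ hat ((hi a ∧ lo b) +ᴱ (hat (lo a) ∧ hi b))
        ≈⟨ -ᴱ-cong (hat-+ _ _) ⟩
      -ᴱ (hat (hi a ∧ lo b) +ᴱ hat (hat (lo a) ∧ hi b))
        ≈⟨ -ᴱ-cong (+ᴱ-cong (hat-∧ (hi a) (lo b)) (hat-∧ (hat (lo a)) (hi b))) ⟩
      -ᴱ ((hat (hi a) ∧ hat (lo b)) +ᴱ (hat (hat (lo a)) ∧ hat (hi b)))
        ≈⟨ 𝓔+-Properties.⁻¹-∙-comm _ _ ⟨
      (-ᴱ (hat (hi a) ∧ hat (lo b))) +ᴱ (-ᴱ (hat (hat (lo a)) ∧ hat (hi b)))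
        ≈⟨ +ᴱ-cong (∧-negˡ _ _) (∧-negʳ _ _) ⟨
      ((-ᴱ hat (hi a)) ∧ hat (lo b)) +ᴱ (hat (hat (lo a)) ∧ (-ᴱ hat (hi b)))
        ≈⟨ +ᴱ-cong (∧-cong (hi-hat a) 𝓔+.refl) (∧-cong 𝓔+.refl (hi-hat b)) ⟨
      (hi (hat a) ∧ lo (hat b)) +ᴱ (hat (lo (hat a)) ∧ hi (hat b))
        ≈⟨ hi-∧ (hat a) (hat b) ⟨
      hi (hat a ∧ hat b)
        ∎)
    where open ≈ᴱ-Reasoning

  hat-∂ : ∀ (a : 𝓔 n) → hat (∂ a) ≈ᴱ (-ᴱ ∂ (hat a))
  hat-∂ {zero}  a = []-ext (trans (*-identityˡ _) (trans (∂-[] a) (sym (trans (-‿cong (∂-[] (hat a))) -0#≈0#))))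
  hat-∂ {suc n} a = lo-hi-ext
    (begin
      hat (lo (∂ a))
        ≈⟨ hat-cong (lo-∂ a) ⟩
      hat (∂ (lo a) +ᴱ hi a)
        ≈⟨ hat-+ _ _ ⟩
      hat (∂ (lo a)) +ᴱ hat (hi a)
        ≈⟨ +ᴱ-cong (hat-∂ (lo a)) (𝓔+.sym (𝓔+-Properties.⁻¹-involutive _)) ⟩
      (-ᴱ ∂ (hat (lo a))) +ᴱ (-ᴱ -ᴱ hat (hi a))
        ≈⟨ 𝓔+-Properties.⁻¹-∙-comm _ _ ⟩
      -ᴱ (∂ (hat (lo a)) +ᴱ (-ᴱ hat (hi a)))
        ≈⟨ -ᴱ-cong (+ᴱ-cong 𝓔+.refl (hi-hat a)) ⟨
      -ᴱ (∂ (lo (hat a)) +ᴱ hi (hat a))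
        ≈⟨ -ᴱ-cong (lo-∂ (hat a)) ⟨
      lo (-ᴱ ∂ (hat a))
        ∎)
    (begin
      hi (hat (∂ a))                 ≈⟨ hi-hat (∂ a) ⟩
      -ᴱ hat (hi (∂ a))              ≈⟨ -ᴱ-cong (hat-cong (hi-∂ a)) ⟩
      -ᴱ hat (-ᴱ ∂ (hi a))           ≈⟨ -ᴱ-cong (hat-neg _) ⟩
      -ᴱ -ᴱ hat (∂ (hi a))           ≈⟨ -ᴱ-cong (-ᴱ-cong (hat-∂ (hi a))) ⟩
      -ᴱ -ᴱ -ᴱ ∂ (hat (hi a))        ≈⟨ -ᴱ-cong (-ᴱ-cong (∂-neg _)) ⟨
      -ᴱ -ᴱ ∂ (-ᴱ hat (hi a))        ≈⟨ -ᴱ-cong (-ᴱ-cong (∂-cong (hi-hat a))) ⟨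
      -ᴱ -ᴱ ∂ (hi (hat a))           ≈⟨ -ᴱ-cong (hi-∂ (hat a)) ⟨
      hi (-ᴱ ∂ (hat a))              ∎)
    where open ≈ᴱ-Reasoning

  ∂∂≈0 : ∀ (a : 𝓔 n) → ∂ (∂ a) ≈ᴱ 0ᴱ
  ∂∂≈0 {zero}  a = []-ext (∂-[] (∂ a))
  ∂∂≈0 {suc n} a = lo-hi-ext
    (begin
      lo (∂ (∂ a))                                 ≈⟨ lo-∂ (∂ a) ⟩
      ∂ (lo (∂ a)) +ᴱ hi (∂ a)                     ≈⟨ +ᴱ-cong (𝓔+.trans (∂-cong (lo-∂ a)) (∂-+ _ _)) (hi-∂ a) ⟩
      (∂ (∂ (lo a)) +ᴱ ∂ (hi a)) +ᴱ (-ᴱ ∂ (hi a))  ≈⟨ +ᴱ-cong (+ᴱ-cong (∂∂≈0 (lo a)) 𝓔+.refl) 𝓔+.refl ⟩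
      (0ᴱ +ᴱ ∂ (hi a)) +ᴱ (-ᴱ ∂ (hi a))            ≈⟨ +ᴱ-cong (𝓔+.identityˡ _) 𝓔+.refl ⟩
      ∂ (hi a) +ᴱ (-ᴱ ∂ (hi a))                    ≈⟨ 𝓔+.inverseʳ _ ⟩
      0ᴱ                                           ∎)
    (begin
      hi (∂ (∂ a))             ≈⟨ hi-∂ (∂ a) ⟩
      -ᴱ ∂ (hi (∂ a))          ≈⟨ -ᴱ-cong (𝓔+.trans (∂-cong (hi-∂ a)) (∂-neg _)) ⟩
      -ᴱ -ᴱ ∂ (∂ (hi a))       ≈⟨ 𝓔+-Properties.⁻¹-involutive _ ⟩
      ∂ (∂ (hi a))             ≈⟨ ∂∂≈0 (hi a) ⟩
      0ᴱ                       ∎)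
    where open ≈ᴱ-Reasoning

  ∧-assoc : ∀ (a b d : 𝓔 n) → ((a ∧ b) ∧ d) ≈ᴱ (a ∧ (b ∧ d))
  ∧-assoc {zero}  a b d = []-ext (begin
    ((a ∧ b) ∧ d) []        ≈⟨ trans (∧-[] (a ∧ b) d) (*-congʳ (∧-[] a b)) ⟩
    (a [] * b []) * d []    ≈⟨ *-assoc _ _ _ ⟩
    a [] * (b [] * d [])    ≈⟨ trans (∧-[] a (b ∧ d)) (*-congˡ (∧-[] b d)) ⟨
    (a ∧ (b ∧ d)) []        ∎)
    where open ≈-Reasoning
  ∧-assoc {suc n} a b d = lo-hi-ext
    (begin
      lo ((a ∧ b) ∧ d)        ≈⟨ 𝓔+.trans (lo-∧ (a ∧ b) d) (∧-cong (lo-∧ a b) 𝓔+.refl) ⟩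
      (lo a ∧ lo b) ∧ lo d    ≈⟨ ∧-assoc (lo a) (lo b) (lo d) ⟩
      lo a ∧ (lo b ∧ lo d)    ≈⟨ 𝓔+.trans (lo-∧ a (b ∧ d)) (∧-cong 𝓔+.refl (lo-∧ b d)) ⟨
      lo (a ∧ (b ∧ d))        ∎)
    (begin
      hi ((a ∧ b) ∧ d)
        ≈⟨ hi-∧ (a ∧ b) d ⟩
      (hi (a ∧ b) ∧ lo d) +ᴱ (hat (lo (a ∧ b)) ∧ hi d)
        ≈⟨ +ᴱ-cong (∧-cong (hi-∧ a b) 𝓔+.refl) (∧-cong (𝓔+.trans (hat-cong (lo-∧ a b)) (hat-∧ (lo a) (lo b))) 𝓔+.refl) ⟩
      (((hi a ∧ lo b) +ᴱ (hat (lo a) ∧ hi b)) ∧ lo d) +ᴱ ((hat (lo a) ∧ hat (lo b)) ∧ hi d)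
        ≈⟨ +ᴱ-cong (∧-distribʳ-+ _ _ _) 𝓔+.refl ⟩
      (((hi a ∧ lo b) ∧ lo d) +ᴱ ((hat (lo a) ∧ hi b) ∧ lo d)) +ᴱ ((hat (lo a) ∧ hat (lo b)) ∧ hi d)
        ≈⟨ +ᴱ-cong (+ᴱ-cong (∧-assoc _ _ _) (∧-assoc _ _ _)) (∧-assoc _ _ _) ⟩
      ((hi a ∧ (lo b ∧ lo d)) +ᴱ (hat (lo a) ∧ (hi b ∧ lo d))) +ᴱ (hat (lo a) ∧ (hat (lo b) ∧ hi d))
        ≈⟨ 𝓔+.assoc _ _ _ ⟩
      (hi a ∧ (lo b ∧ lo d)) +ᴱ ((hat (lo a) ∧ (hi b ∧ lo d)) +ᴱ (hat (lo a) ∧ (hat (lo b) ∧ hi d)))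
        ≈⟨ +ᴱ-cong 𝓔+.refl (∧-distribˡ-+ _ _ _) ⟨
      (hi a ∧ (lo b ∧ lo d)) +ᴱ (hat (lo a) ∧ ((hi b ∧ lo d) +ᴱ (hat (lo b) ∧ hi d)))
        ≈⟨ +ᴱ-cong (∧-cong 𝓔+.refl (lo-∧ b d)) (∧-cong 𝓔+.refl (hi-∧ b d)) ⟨
      (hi a ∧ lo (b ∧ d)) +ᴱ (hat (lo a) ∧ hi (b ∧ d))
        ≈⟨ hi-∧ a (b ∧ d) ⟨
      hi (a ∧ (b ∧ d))
        ∎)
    where open ≈ᴱ-Reasoning

  ∂-leibniz : ∀ (a b : 𝓔 n) → ∂ (a ∧ b) ≈ᴱ ((∂ a ∧ b) +ᴱ (hat a ∧ ∂ b))
  ∂-leibniz {zero} a b = []-ext (begin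
    ∂ (a ∧ b) []                               ≈⟨ ∂-[] (a ∧ b) ⟩
    0#                                         ≈⟨ +-identityʳ 0# ⟨
    0# + 0#                                    ≈⟨ +-cong (zeroˡ (b [])) (zeroʳ (hat a [])) ⟨
    0# * b [] + hat a [] * 0#                  ≈⟨ +-cong (*-congʳ (∂-[] a)) (*-congˡ (∂-[] b)) ⟨
    ∂ a [] * b [] + hat a [] * ∂ b []          ≈⟨ +-cong (∧-[] (∂ a) b) (∧-[] (hat a) (∂ b)) ⟨
    (∂ a ∧ b) [] + (hat a ∧ ∂ b) []            ∎)
    where open ≈-Reasoning
  ∂-leibniz {suc n} a b = lo-hi-ext lo-case hi-case
    where
    open ≈ᴱ-Reasoning
    open CommutativeMonoidSolver (𝓔+.commutativeMonoid {n}) using (solve; _⊜_; _⊕_)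

    lo-case : lo (∂ (a ∧ b)) ≈ᴱ lo ((∂ a ∧ b) +ᴱ (hat a ∧ ∂ b))
    lo-case = begin
      lo (∂ (a ∧ b))
        ≈⟨ lo-∂ (a ∧ b) ⟩
      ∂ (lo (a ∧ b)) +ᴱ hi (a ∧ b)
        ≈⟨ +ᴱ-cong (𝓔+.trans (∂-cong (lo-∧ a b)) (∂-leibniz (lo a) (lo b))) (hi-∧ a b) ⟩
      ((∂ (lo a) ∧ lo b) +ᴱ (hat (lo a) ∧ ∂ (lo b))) +ᴱ ((hi a ∧ lo b) +ᴱ (hat (lo a) ∧ hi b))
        ≈⟨ solve 4 (λ p q r s → (p ⊕ q) ⊕ (r ⊕ s) ⊜ (p ⊕ r) ⊕ (q ⊕ s)) 𝓔+.refl _ _ _ _ ⟩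
      ((∂ (lo a) ∧ lo b) +ᴱ (hi a ∧ lo b)) +ᴱ ((hat (lo a) ∧ ∂ (lo b)) +ᴱ (hat (lo a) ∧ hi b))
        ≈⟨ +ᴱ-cong (∧-distribʳ-+ _ _ _) (∧-distribˡ-+ _ _ _) ⟨
      ((∂ (lo a) +ᴱ hi a) ∧ lo b) +ᴱ (hat (lo a) ∧ (∂ (lo b) +ᴱ hi b))
        ≈⟨ +ᴱ-cong (𝓔+.trans (lo-∧ (∂ a) b) (∧-cong (lo-∂ a) 𝓔+.refl))
                   (𝓔+.trans (lo-∧ (hat a) (∂ b)) (∧-cong 𝓔+.refl (lo-∂ b))) ⟨
      lo (∂ a ∧ b) +ᴱ lo (hat a ∧ ∂ b)
        ∎

    -- F occurs in both hi (∂ a ∧ b) and hi (hat a ∧ ∂ b), with opposite signs.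
    A B C D F : 𝓔 n
    A = ∂ (hi a) ∧ lo b
    B = hat (hi a) ∧ ∂ (lo b)
    C = ∂ (hat (lo a)) ∧ hi b
    D = hat (hat (lo a)) ∧ ∂ (hi b)
    F = hat (hi a) ∧ hi b

    hi-∂[a∧b] : hi (∂ (a ∧ b)) ≈ᴱ (-ᴱ ((A +ᴱ B) +ᴱ (C +ᴱ D)))
    hi-∂[a∧b] = begin
      hi (∂ (a ∧ b))
        ≈⟨ hi-∂ (a ∧ b) ⟩
      -ᴱ ∂ (hi (a ∧ b))
        ≈⟨ -ᴱ-cong (∂-cong (hi-∧ a b)) ⟩
      -ᴱ ∂ ((hi a ∧ lo b) +ᴱ (hat (lo a) ∧ hi b))
        ≈⟨ -ᴱ-cong (∂-+ _ _) ⟩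
      -ᴱ (∂ (hi a ∧ lo b) +ᴱ ∂ (hat (lo a) ∧ hi b))
        ≈⟨ -ᴱ-cong (+ᴱ-cong (∂-leibniz (hi a) (lo b)) (∂-leibniz (hat (lo a)) (hi b))) ⟩
      -ᴱ ((A +ᴱ B) +ᴱ (C +ᴱ D))
        ∎

    hi-∂a∧b : hi (∂ a ∧ b) ≈ᴱ ((-ᴱ A) +ᴱ ((-ᴱ C) +ᴱ F))
    hi-∂a∧b = begin
      hi (∂ a ∧ b)
        ≈⟨ hi-∧ (∂ a) b ⟩
      (hi (∂ a) ∧ lo b) +ᴱ (hat (lo (∂ a)) ∧ hi b)
        ≈⟨ +ᴱ-cong (∧-cong (hi-∂ a) 𝓔+.refl)
          (∧-cong (𝓔+.trans (hat-cong (lo-∂ a)) (hat-+ _ _)) 𝓔+.refl) ⟩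
      ((-ᴱ ∂ (hi a)) ∧ lo b) +ᴱ ((hat (∂ (lo a)) +ᴱ hat (hi a)) ∧ hi b)
        ≈⟨ +ᴱ-cong (∧-negˡ _ _) (∧-distribʳ-+ _ _ _) ⟩
      (-ᴱ A) +ᴱ ((hat (∂ (lo a)) ∧ hi b) +ᴱ F)
        ≈⟨ +ᴱ-cong 𝓔+.refl (+ᴱ-cong (𝓔+.trans (∧-cong (hat-∂ (lo a)) 𝓔+.refl) (∧-negˡ _ _)) 𝓔+.refl) ⟩
      (-ᴱ A) +ᴱ ((-ᴱ C) +ᴱ F)
        ∎

    hi-hat-a∧∂b : hi (hat a ∧ ∂ b) ≈ᴱ (((-ᴱ B) +ᴱ (-ᴱ F)) +ᴱ (-ᴱ D))
    hi-hat-a∧∂b = begin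
      hi (hat a ∧ ∂ b)
        ≈⟨ hi-∧ (hat a) (∂ b) ⟩
      (hi (hat a) ∧ lo (∂ b)) +ᴱ (hat (lo (hat a)) ∧ hi (∂ b))
        ≈⟨ +ᴱ-cong (∧-cong (hi-hat a) (lo-∂ b)) (∧-cong 𝓔+.refl (hi-∂ b)) ⟩
      ((-ᴱ hat (hi a)) ∧ (∂ (lo b) +ᴱ hi b)) +ᴱ (hat (hat (lo a)) ∧ (-ᴱ ∂ (hi b)))
        ≈⟨ +ᴱ-cong (∧-distribˡ-+ _ _ _) (∧-negʳ _ _) ⟩
      (((-ᴱ hat (hi a)) ∧ ∂ (lo b)) +ᴱ ((-ᴱ hat (hi a)) ∧ hi b)) +ᴱ (-ᴱ D)
        ≈⟨ +ᴱ-cong (+ᴱ-cong (∧-negˡ _ _) (∧-negˡ _ _)) 𝓔+.refl ⟩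
      ((-ᴱ B) +ᴱ (-ᴱ F)) +ᴱ (-ᴱ D)
        ∎

    hi-case : hi (∂ (a ∧ b)) ≈ᴱ hi ((∂ a ∧ b) +ᴱ (hat a ∧ ∂ b))
    hi-case = begin
      hi (∂ (a ∧ b))
        ≈⟨ hi-∂[a∧b] ⟩
      -ᴱ ((A +ᴱ B) +ᴱ (C +ᴱ D))
        ≈⟨ 𝓔+-Properties.⁻¹-∙-comm _ _ ⟨
      (-ᴱ (A +ᴱ B)) +ᴱ (-ᴱ (C +ᴱ D))
        ≈⟨ +ᴱ-cong (𝓔+-Properties.⁻¹-∙-comm _ _) (𝓔+-Properties.⁻¹-∙-comm _ _) ⟨
      ((-ᴱ A) +ᴱ (-ᴱ B)) +ᴱ ((-ᴱ C) +ᴱ (-ᴱ D))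
        ≈⟨ 𝓔+.identityʳ _ ⟨
      (((-ᴱ A) +ᴱ (-ᴱ B)) +ᴱ ((-ᴱ C) +ᴱ (-ᴱ D))) +ᴱ 0ᴱ
        ≈⟨ +ᴱ-cong 𝓔+.refl (𝓔+.inverseʳ F) ⟨
      (((-ᴱ A) +ᴱ (-ᴱ B)) +ᴱ ((-ᴱ C) +ᴱ (-ᴱ D))) +ᴱ (F +ᴱ (-ᴱ F))
        ≈⟨ solve 6 (λ p q r s t u → ((p ⊕ q) ⊕ (r ⊕ s)) ⊕ (t ⊕ u) ⊜ (p ⊕ (r ⊕ t)) ⊕ ((q ⊕ u) ⊕ s)) 𝓔+.refl _ _ _ _ _ _ ⟩
      ((-ᴱ A) +ᴱ ((-ᴱ C) +ᴱ F)) +ᴱ (((-ᴱ B) +ᴱ (-ᴱ F)) +ᴱ (-ᴱ D))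
        ≈⟨ +ᴱ-cong hi-∂a∧b hi-hat-a∧∂b ⟨
      hi (∂ a ∧ b) +ᴱ hi (hat a ∧ ∂ b)
        ∎

  e-∧-e : ∀ (U V : Subset n) → (e U ∧ e V) ≈ᴱ μ U V
  e-∧-e U V Z = begin
    ΣS (λ X → ΣS (λ Y → μ X Y Z * (e U X * e V Y)))
      ≈⟨ ΣS-single U (λ X → ΣS (λ Y → μ X Y Z * (e U X * e V Y)))
           (λ X X≢U → ΣS-zero λ Y → trans (*-congˡ (trans (*-congʳ (e-≢ U X X≢U)) (zeroˡ (e V Y)))) (zeroʳ (μ X Y Z))) ⟩
    ΣS (λ Y → μ U Y Z * (e U U * e V Y))
      ≈⟨ ΣS-single V (λ Y → μ U Y Z * (e U U * e V Y))
           (λ Y Y≢V → trans (*-congˡ (trans (*-congˡ (e-≢ V Y Y≢V)) (zeroʳ _))) (zeroʳ _)) ⟩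
    μ U V Z * (e U U * e V V)
      ≈⟨ *-congˡ (trans (*-cong (e-≡ U U ≡.refl) (e-≡ V V ≡.refl)) (*-identityˡ 1#)) ⟩
    μ U V Z * 1#
      ≈⟨ *-identityʳ _ ⟩
    μ U V Z ∎
    where open ≈-Reasoning

  μ-disjoint-e : ∀ (U V : Subset n) → U ∩ V ≡ ⊥ → ∀ Z → μ U V Z ≈ sgn (inv U V) * e (U ∪ V) Z
  μ-disjoint-e U V U∩V≡⊥ Z with Z ≟ˢ (U ∪ V)
  ... | yes ≡.refl = trans (μ-disjoint U V Z U∩V≡⊥ ≡.refl) (sym (*-identityʳ _))
  ... | no Z≢U∪V   = trans (μ-∪≢ U V Z (Z≢U∪V ∘ ≡.sym)) (sym (zeroʳ _))

  e-∧-e-disjoint : ∀ (U V : Subset n) → U ∩ V ≡ ⊥ → (e U ∧ e V) ≈ᴱ (sgn (inv U V) ·ᴱ e (U ∪ V))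
  e-∧-e-disjoint U V U∩V≡⊥ Z = trans (e-∧-e U V Z) (μ-disjoint-e U V U∩V≡⊥ Z)

  e-∧-e-overlap : ∀ (U V : Subset n) → U ∩ V ≢ ⊥ → (e U ∧ e V) ≈ᴱ 0ᴱ
  e-∧-e-overlap U V U∩V≢⊥ Z = trans (e-∧-e U V Z) (μ-overlap U V Z U∩V≢⊥)

  lo-∂-e-outside : ∀ (X : Subset n) → lo (∂ (e (outside ∷ X))) ≈ᴱ ∂ (e X)
  lo-∂-e-outside X = begin
    lo (∂ (e (outside ∷ X)))                         ≈⟨ lo-∂ (e (outside ∷ X)) ⟩
    ∂ (lo (e (outside ∷ X))) +ᴱ hi (e (outside ∷ X)) ≈⟨ +ᴱ-cong (∂-cong (lo-e-outside X)) (hi-e-outside X) ⟩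
    ∂ (e X) +ᴱ 0ᴱ                                    ≈⟨ 𝓔+.identityʳ _ ⟩
    ∂ (e X)                                          ∎
    where open ≈ᴱ-Reasoning

  hi-∂-e-outside : ∀ (X : Subset n) → hi (∂ (e (outside ∷ X))) ≈ᴱ 0ᴱ
  hi-∂-e-outside X = begin
    hi (∂ (e (outside ∷ X)))     ≈⟨ hi-∂ (e (outside ∷ X)) ⟩
    -ᴱ ∂ (hi (e (outside ∷ X)))  ≈⟨ -ᴱ-cong (𝓔+.trans (∂-cong (hi-e-outside X)) ∂-zero) ⟩
    -ᴱ 0ᴱ                        ≈⟨ 𝓔+-Properties.ε⁻¹≈ε ⟩
    0ᴱ                           ∎
    where open ≈ᴱ-Reasoning

  lo-∂-e-inside : ∀ (X : Subset n) → lo (∂ (e (inside ∷ X))) ≈ᴱ e X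
  lo-∂-e-inside X = begin
    lo (∂ (e (inside ∷ X)))                        ≈⟨ lo-∂ (e (inside ∷ X)) ⟩
    ∂ (lo (e (inside ∷ X))) +ᴱ hi (e (inside ∷ X)) ≈⟨ +ᴱ-cong (𝓔+.trans (∂-cong (lo-e-inside X)) ∂-zero) (hi-e-inside X) ⟩
    0ᴱ +ᴱ e X                                      ≈⟨ 𝓔+.identityˡ _ ⟩
    e X                                            ∎
    where open ≈ᴱ-Reasoning

  hi-∂-e-inside : ∀ (X : Subset n) → hi (∂ (e (inside ∷ X))) ≈ᴱ (-ᴱ ∂ (e X))
  hi-∂-e-inside X = 𝓔+.trans (hi-∂ (e (inside ∷ X))) (-ᴱ-cong (∂-cong (hi-e-inside X)))

  ∂1ᴱ≈0 : ∂ {n} 1ᴱ ≈ᴱ 0ᴱ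
  ∂1ᴱ≈0 {zero}  = []-ext (∂-[] 1ᴱ)
  ∂1ᴱ≈0 {suc n} = lo-hi-ext (𝓔+.trans (lo-∂-e-outside ⊥) ∂1ᴱ≈0) (hi-∂-e-outside ⊥)

  ∂e⁅x⁆≈1ᴱ : ∀ (x : Fin n) → ∂ (e ⁅ x ⁆) ≈ᴱ 1ᴱ
  ∂e⁅x⁆≈1ᴱ Fin.zero = lo-hi-ext
    (𝓔+.trans (lo-∂-e-inside ⊥) (𝓔+.sym (lo-e-outside ⊥)))
    (begin
      hi (∂ (e ⁅ Fin.zero ⁆))  ≈⟨ hi-∂-e-inside ⊥ ⟩
      -ᴱ ∂ 1ᴱ                  ≈⟨ -ᴱ-cong ∂1ᴱ≈0 ⟩
      -ᴱ 0ᴱ                    ≈⟨ 𝓔+-Properties.ε⁻¹≈ε ⟩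
      0ᴱ                       ≈⟨ hi-e-outside ⊥ ⟨
      hi 1ᴱ                    ∎)
    where open ≈ᴱ-Reasoning
  ∂e⁅x⁆≈1ᴱ (Fin.suc x) = lo-hi-ext
    (𝓔+.trans (lo-∂-e-outside ⁅ x ⁆) (𝓔+.trans (∂e⁅x⁆≈1ᴱ x) (𝓔+.sym (lo-e-outside ⊥))))
    (𝓔+.trans (hi-∂-e-outside ⁅ x ⁆) (𝓔+.sym (hi-e-outside ⊥)))

  hat-e⁅x⁆ : ∀ (x : Fin n) → hat (e ⁅ x ⁆) ≈ᴱ (-ᴱ e ⁅ x ⁆)
  hat-e⁅x⁆ x Z = trans (hat-e ⁅ x ⁆ Z) (trans (*-congʳ (reflexive (≡.cong sgn (∣⁅x⁆∣≡1 x)))) (-1*x≈-x _))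

  e⁅x⁆∧w∧e⁅x⁆≈0 : ∀ (x : Fin n) (w : 𝓔 n) → ((e ⁅ x ⁆ ∧ w) ∧ e ⁅ x ⁆) ≈ᴱ 0ᴱ
  e⁅x⁆∧w∧e⁅x⁆≈0 Fin.zero w = lo-hi-ext
    (begin
      lo ((E ∧ w) ∧ E)       ≈⟨ lo-∧ (E ∧ w) E ⟩
      lo (E ∧ w) ∧ lo E      ≈⟨ ∧-cong 𝓔+.refl (lo-e-inside ⊥) ⟩
      lo (E ∧ w) ∧ 0ᴱ        ≈⟨ ∧-zeroʳ _ ⟩
      0ᴱ                     ∎)
    (begin
      hi ((E ∧ w) ∧ E)
        ≈⟨ hi-∧ (E ∧ w) E ⟩
      (hi (E ∧ w) ∧ lo E) +ᴱ (hat (lo (E ∧ w)) ∧ hi E)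
        ≈⟨ +ᴱ-cong (∧-cong 𝓔+.refl (lo-e-inside ⊥)) (∧-cong (hat-cong lo[E∧w]≈0) 𝓔+.refl) ⟩
      (hi (E ∧ w) ∧ 0ᴱ) +ᴱ (hat 0ᴱ ∧ hi E)
        ≈⟨ +ᴱ-cong (∧-zeroʳ _) (𝓔+.trans (∧-cong hat-zero 𝓔+.refl) (∧-zeroˡ _)) ⟩
      0ᴱ +ᴱ 0ᴱ
        ≈⟨ 𝓔+.identityʳ 0ᴱ ⟩
      0ᴱ
        ∎)
    where
    open ≈ᴱ-Reasoning
    E : 𝓔 (suc _)
    E = e ⁅ Fin.zero ⁆
    lo[E∧w]≈0 : lo (E ∧ w) ≈ᴱ 0ᴱ
    lo[E∧w]≈0 = 𝓔+.trans (lo-∧ E w) (𝓔+.trans (∧-cong (lo-e-inside ⊥) 𝓔+.refl) (∧-zeroˡ _))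
  e⁅x⁆∧w∧e⁅x⁆≈0 (Fin.suc x) w = lo-hi-ext
    (begin
      lo ((E ∧ w) ∧ E)          ≈⟨ 𝓔+.trans (lo-∧ (E ∧ w) E) (∧-cong (lo-∧ E w) 𝓔+.refl) ⟩
      (lo E ∧ lo w) ∧ lo E      ≈⟨ ∧-cong (∧-cong (lo-e-outside ⁅ x ⁆) 𝓔+.refl) (lo-e-outside ⁅ x ⁆) ⟩
      (E′ ∧ lo w) ∧ E′          ≈⟨ e⁅x⁆∧w∧e⁅x⁆≈0 x (lo w) ⟩
      0ᴱ                        ∎)
    (begin
      hi ((E ∧ w) ∧ E)
        ≈⟨ hi-∧ (E ∧ w) E ⟩
      (hi (E ∧ w) ∧ lo E) +ᴱ (hat (lo (E ∧ w)) ∧ hi E)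
        ≈⟨ +ᴱ-cong (∧-cong (hi-∧ E w) (lo-e-outside ⁅ x ⁆)) (𝓔+.trans (∧-cong 𝓔+.refl (hi-e-outside ⁅ x ⁆)) (∧-zeroʳ _)) ⟩
      (((hi E ∧ lo w) +ᴱ (hat (lo E) ∧ hi w)) ∧ E′) +ᴱ 0ᴱ
        ≈⟨ 𝓔+.identityʳ _ ⟩
      ((hi E ∧ lo w) +ᴱ (hat (lo E) ∧ hi w)) ∧ E′
        ≈⟨ ∧-cong (+ᴱ-cong (𝓔+.trans (∧-cong (hi-e-outside ⁅ x ⁆) 𝓔+.refl) (∧-zeroˡ _))
                           (∧-cong (𝓔+.trans (hat-cong (lo-e-outside ⁅ x ⁆)) (hat-e⁅x⁆ x)) 𝓔+.refl)) 𝓔+.refl ⟩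
      (0ᴱ +ᴱ ((-ᴱ E′) ∧ hi w)) ∧ E′
        ≈⟨ ∧-cong (𝓔+.trans (𝓔+.identityˡ _) (∧-negˡ _ _)) 𝓔+.refl ⟩
      (-ᴱ (E′ ∧ hi w)) ∧ E′
        ≈⟨ ∧-negˡ _ _ ⟩
      -ᴱ ((E′ ∧ hi w) ∧ E′)
        ≈⟨ -ᴱ-cong (e⁅x⁆∧w∧e⁅x⁆≈0 x (hi w)) ⟩
      -ᴱ 0ᴱ
        ≈⟨ 𝓔+-Properties.ε⁻¹≈ε ⟩
      0ᴱ ∎)
    where
    open ≈ᴱ-Reasoning
    E : 𝓔 (suc _)
    E = e ⁅ Fin.suc x ⁆
    E′ : 𝓔 _
    E′ = e ⁅ x ⁆

  ∂[e⁅x⁆∧a] : ∀ (x : Fin n) a → ∂ (e ⁅ x ⁆ ∧ a) ≈ᴱ (a +ᴱ (-ᴱ (e ⁅ x ⁆ ∧ ∂ a)))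
  ∂[e⁅x⁆∧a] x a = begin
    ∂ (e ⁅ x ⁆ ∧ a)                                  ≈⟨ ∂-leibniz (e ⁅ x ⁆) a ⟩
    (∂ (e ⁅ x ⁆) ∧ a) +ᴱ (hat (e ⁅ x ⁆) ∧ ∂ a)        ≈⟨ +ᴱ-cong (𝓔+.trans (∧-cong (∂e⁅x⁆≈1ᴱ x) 𝓔+.refl) (∧-identityˡ a))
                                                                (𝓔+.trans (∧-cong (hat-e⁅x⁆ x) 𝓔+.refl) (∧-negˡ _ _)) ⟩
    a +ᴱ (-ᴱ (e ⁅ x ⁆ ∧ ∂ a))                        ∎
    where open ≈ᴱ-Reasoning

  e⁅x⁆∧-homotopy : ∀ (x : Fin n) a → (∂ (e ⁅ x ⁆ ∧ a) +ᴱ (e ⁅ x ⁆ ∧ ∂ a)) ≈ᴱ a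
  e⁅x⁆∧-homotopy x a = begin
    ∂ (e ⁅ x ⁆ ∧ a) +ᴱ (e ⁅ x ⁆ ∧ ∂ a)                  ≈⟨ +ᴱ-cong (∂[e⁅x⁆∧a] x a) 𝓔+.refl ⟩
    (a +ᴱ (-ᴱ (e ⁅ x ⁆ ∧ ∂ a))) +ᴱ (e ⁅ x ⁆ ∧ ∂ a)     ≈⟨ 𝓔+.assoc _ _ _ ⟩
    a +ᴱ ((-ᴱ (e ⁅ x ⁆ ∧ ∂ a)) +ᴱ (e ⁅ x ⁆ ∧ ∂ a))     ≈⟨ +ᴱ-cong 𝓔+.refl (𝓔+.inverseˡ _) ⟩
    a +ᴱ 0ᴱ                                            ≈⟨ 𝓔+.identityʳ a ⟩
    a                                                  ∎
    where open ≈ᴱ-Reasoning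

  e⁅x⁆∧e≈0 : x ∈ X → (e ⁅ x ⁆ ∧ e X) ≈ᴱ 0ᴱ
  e⁅x⁆∧e≈0 {x = x} {X = X} x∈X = e-∧-e-overlap ⁅ x ⁆ X λ ⁅x⁆∩X≡⊥ →
    ∉⊥ (≡.subst (x ∈_) ⁅x⁆∩X≡⊥ (x∈p∩q⁺ (x∈⁅x⁆ x , x∈X)))

  e≈e⁅x⁆∧∂e : x ∈ X → e X ≈ᴱ (e ⁅ x ⁆ ∧ ∂ (e X))
  e≈e⁅x⁆∧∂e {x = x} {X = X} x∈X = begin
    e X                                          ≈⟨ e⁅x⁆∧-homotopy x (e X) ⟨
    ∂ (e ⁅ x ⁆ ∧ e X) +ᴱ (e ⁅ x ⁆ ∧ ∂ (e X))     ≈⟨ +ᴱ-cong (𝓔+.trans (∂-cong (e⁅x⁆∧e≈0 x∈X)) ∂-zero) 𝓔+.refl ⟩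
    0ᴱ +ᴱ (e ⁅ x ⁆ ∧ ∂ (e X))                    ≈⟨ 𝓔+.identityˡ _ ⟩
    e ⁅ x ⁆ ∧ ∂ (e X)                            ∎
    where open ≈ᴱ-Reasoning

  -- inv ⁅ x ⁆ (X - x) counts the elements of X below x: e_X = ± e_x ∧ e_{X∖x} with this sign.
  rank : Fin n → Subset n → ℕ
  rank x X = inv ⁅ x ⁆ (X - x)

  e⁅x⁆∧e[X-x] : x ∈ X → (e ⁅ x ⁆ ∧ e (X - x)) ≈ᴱ (sgn (rank x X) ·ᴱ e X)
  e⁅x⁆∧e[X-x] {x = x} {X = X} x∈X Z = trans
    (e-∧-e-disjoint ⁅ x ⁆ (X - x) (p∩[q─p]≡⊥ ⁅ x ⁆ X) Z)
    (*-congˡ (e-cong (p⊆q⇒p∪[q─p]≡q (x∈p⇒⁅x⁆⊆p x∈X)) Z))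

  module _ {g} {G : 𝓔 n → Set g} where

    Ideal-· : ∀ k → Ideal G a → Ideal G (k ·ᴱ a)
    Ideal-· {a = a} k a∈I = resp (𝓔+.trans (∧-·ˡ k 1ᴱ a) (·ᴱ-congˡ k (∧-identityˡ a))) (mulˡ (k ·ᴱ 1ᴱ) a∈I)

    Ideal-neg : Ideal G a → Ideal G (-ᴱ a)
    Ideal-neg {a = a} a∈I = resp (𝓔+.sym (-ᴱ≈-1·ᴱ a)) (Ideal-· (- 1#) a∈I)

    Ideal-e : x ∈ X → Ideal G (e (X - x)) → Ideal G (e X)
    Ideal-e {x = x} {X = X} x∈X e[X-x]∈I = resp e≈ (Ideal-· (sgn (rank x X)) (mulˡ (e ⁅ x ⁆) e[X-x]∈I))
      where
      e≈ : (sgn (rank x X) ·ᴱ (e ⁅ x ⁆ ∧ e (X - x))) ≈ᴱ e X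
      e≈ = 𝓔+.trans (·ᴱ-congˡ _ (e⁅x⁆∧e[X-x] x∈X)) (·ᴱ-sgn-involutive (rank x X) (e X))

    Ideal-∂[e⁅x⁆∧e[X-x]] : x ∈ X → Ideal G (∂ (e X)) → Ideal G (∂ (e ⁅ x ⁆ ∧ e (X - x)))
    Ideal-∂[e⁅x⁆∧e[X-x]] {x = x} {X = X} x∈X ∂e∈I =
      resp (𝓔+.sym (𝓔+.trans (∂-cong (e⁅x⁆∧e[X-x] x∈X)) (∂-· _ _))) (Ideal-· (sgn (rank x X)) ∂e∈I)

    Ideal-e⁅x⁆∧e[X-x] : x ∈ X → Ideal G (e X) → Ideal G (e ⁅ x ⁆ ∧ e (X - x))
    Ideal-e⁅x⁆∧e[X-x] {x = x} {X = X} x∈X e∈I = resp (𝓔+.sym (e⁅x⁆∧e[X-x] x∈X)) (Ideal-· (sgn (rank x X)) e∈I)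

    Ideal-∧ : ∀ (x : Fin n) a b → Ideal G (∂ (e ⁅ x ⁆ ∧ a)) → Ideal G (∂ (e ⁅ x ⁆ ∧ b)) → Ideal G (a ∧ b)
    Ideal-∧ x a b ∂[E∧a]∈I ∂[E∧b]∈I = resp (𝓔+.sym a∧b≈) (add (mulʳ ∂[E∧a]∈I b) (mulˡ (E ∧ ∂ a) ∂[E∧b]∈I))
      where
      open ≈ᴱ-Reasoning
      E : 𝓔 n
      E = e ⁅ x ⁆
      a∧b≈ : (a ∧ b) ≈ᴱ ((∂ (E ∧ a) ∧ b) +ᴱ ((E ∧ ∂ a) ∧ ∂ (E ∧ b)))
      a∧b≈ = begin
        a ∧ b
          ≈⟨ ∧-cong (e⁅x⁆∧-homotopy x a) 𝓔+.refl ⟨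
        (∂ (E ∧ a) +ᴱ (E ∧ ∂ a)) ∧ b
          ≈⟨ ∧-distribʳ-+ b _ _ ⟩
        (∂ (E ∧ a) ∧ b) +ᴱ ((E ∧ ∂ a) ∧ b)
          ≈⟨ +ᴱ-cong 𝓔+.refl (∧-cong 𝓔+.refl (e⁅x⁆∧-homotopy x b)) ⟨
        (∂ (E ∧ a) ∧ b) +ᴱ ((E ∧ ∂ a) ∧ (∂ (E ∧ b) +ᴱ (E ∧ ∂ b)))
          ≈⟨ +ᴱ-cong 𝓔+.refl (∧-distribˡ-+ _ _ _) ⟩
        (∂ (E ∧ a) ∧ b) +ᴱ (((E ∧ ∂ a) ∧ ∂ (E ∧ b)) +ᴱ ((E ∧ ∂ a) ∧ (E ∧ ∂ b)))
          ≈⟨ +ᴱ-cong 𝓔+.refl (+ᴱ-cong 𝓔+.refl E∧∂a∧E∧∂b≈0) ⟩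
        (∂ (E ∧ a) ∧ b) +ᴱ (((E ∧ ∂ a) ∧ ∂ (E ∧ b)) +ᴱ 0ᴱ)
          ≈⟨ +ᴱ-cong 𝓔+.refl (𝓔+.identityʳ _) ⟩
        (∂ (E ∧ a) ∧ b) +ᴱ ((E ∧ ∂ a) ∧ ∂ (E ∧ b))
          ∎
        where
        E∧∂a∧E∧∂b≈0 : ((E ∧ ∂ a) ∧ (E ∧ ∂ b)) ≈ᴱ 0ᴱ
        E∧∂a∧E∧∂b≈0 = 𝓔+.trans (𝓔+.sym (∧-assoc _ _ _))
                        (𝓔+.trans (∧-cong (e⁅x⁆∧w∧e⁅x⁆≈0 x (∂ a)) 𝓔+.refl) (∧-zeroˡ _))

  module _ {p} {𝔛 : Subset n → Set p} where

    Im-hat : Im 𝔛 a → Im 𝔛 (hat a)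
    Im-hat (gen (Y , Y∈𝔛 , ≡.refl)) = resp hat∂e≈ (Ideal-· (- sgn ∣ Y ∣) (gen (Y , Y∈𝔛 , ≡.refl)))
      where
      open ≈ᴱ-Reasoning
      hat∂e≈ : ((- sgn ∣ Y ∣) ·ᴱ ∂ (e Y)) ≈ᴱ hat (∂ (e Y))
      hat∂e≈ = begin
        (- sgn ∣ Y ∣) ·ᴱ ∂ (e Y)     ≈⟨ (λ Z → sym (-‿distribˡ-* _ _)) ⟩
        -ᴱ (sgn ∣ Y ∣ ·ᴱ ∂ (e Y))    ≈⟨ -ᴱ-cong (𝓔+.trans (∂-cong (hat-e Y)) (∂-· _ _)) ⟨
        -ᴱ ∂ (hat (e Y))             ≈⟨ hat-∂ (e Y) ⟨
        hat (∂ (e Y))                ∎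
    Im-hat zer                = resp (𝓔+.sym hat-zero) zer
    Im-hat (add a∈ b∈)        = resp (𝓔+.sym (hat-+ _ _)) (add (Im-hat a∈) (Im-hat b∈))
    Im-hat (mulˡ d {a} a∈)    = resp (𝓔+.sym (hat-∧ d a)) (mulˡ (hat d) (Im-hat a∈))
    Im-hat (mulʳ {a} a∈ d)    = resp (𝓔+.sym (hat-∧ a d)) (mulʳ (Im-hat a∈) (hat d))
    Im-hat (resp a≈b a∈)      = resp (hat-cong a≈b) (Im-hat a∈)

    Im-∂ : Im 𝔛 a → Im 𝔛 (∂ a)
    Im-∂ (gen (Y , _ , ≡.refl)) = resp (𝓔+.sym (∂∂≈0 (e Y))) zer
    Im-∂ zer                    = resp (𝓔+.sym ∂-zero) zer
    Im-∂ (add a∈ b∈)            = resp (𝓔+.sym (∂-+ _ _)) (add (Im-∂ a∈) (Im-∂ b∈))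
    Im-∂ (mulˡ d {a} a∈)        = resp (𝓔+.sym (∂-leibniz d a)) (add (mulˡ (∂ d) a∈) (mulˡ (hat d) (Im-∂ a∈)))
    Im-∂ (mulʳ {a} a∈ d)        = resp (𝓔+.sym (∂-leibniz a d)) (add (mulʳ (Im-∂ a∈) d) (mulʳ (Im-hat a∈) (∂ d)))
    Im-∂ (resp a≈b a∈)          = resp (∂-cong a≈b) (Im-∂ a∈)

  record AdditiveSubgroup {p} (P : 𝓔 n → Set p) : Set (c ⊔ ℓ ⊔ p) where
    field
      ≈-closed   : ∀ {a b} → a ≈ᴱ b → P a → P b
      0-closed   : P 0ᴱ
      +-closed   : ∀ {a b} → P a → P b → P (a +ᴱ b)
      neg-closed : ∀ {a} → P a → P (-ᴱ a)

  Ideal-additiveSubgroup : ∀ {g} {G : 𝓔 n → Set g} → AdditiveSubgroup (Ideal G)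
  Ideal-additiveSubgroup = record { ≈-closed = resp ; 0-closed = zer ; +-closed = add ; neg-closed = Ideal-neg }

  AdditiveSubgroup-preimage : ∀ {m p} {P : 𝓔 n → Set p} (f : 𝓔 m → 𝓔 n) →
    (∀ {a b} → a ≈ᴱ b → f a ≈ᴱ f b) → f 0ᴱ ≈ᴱ 0ᴱ →
    (∀ a b → f (a +ᴱ b) ≈ᴱ (f a +ᴱ f b)) → (∀ a → f (-ᴱ a) ≈ᴱ (-ᴱ f a)) →
    AdditiveSubgroup P → AdditiveSubgroup (P ∘ f)
  AdditiveSubgroup-preimage f f-cong f-0 f-+ f-neg P-subgroup = record
    { ≈-closed   = ≈-closed ∘ f-cong
    ; 0-closed   = ≈-closed (𝓔+.sym f-0) 0-closed
    ; +-closed   = λ {a b} fa∈P fb∈P → ≈-closed (𝓔+.sym (f-+ a b)) (+-closed fa∈P fb∈P)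
    ; neg-closed = λ {a} fa∈P → ≈-closed (𝓔+.sym (f-neg a)) (neg-closed fa∈P)
    }
    where open AdditiveSubgroup P-subgroup

  -- cons u v = u + e₀ ∧ v
  cons : 𝓔 n → 𝓔 n → 𝓔 (suc n)
  cons u v (outside ∷ Z) = u Z
  cons u v (inside  ∷ Z) = v Z

  consˡ-subgroup : ∀ {p} {P : 𝓔 (suc n) → Set p} → AdditiveSubgroup P → AdditiveSubgroup (P ∘ (λ u → cons u 0ᴱ))
  consˡ-subgroup = AdditiveSubgroup-preimage (λ u → cons u 0ᴱ)
    (λ u≈ → lo-hi-ext u≈ 𝓔+.refl) (lo-hi-ext 𝓔+.refl 𝓔+.refl)
    (λ u u′ → lo-hi-ext 𝓔+.refl (𝓔+.sym (𝓔+.identityʳ 0ᴱ))) (λ u → lo-hi-ext 𝓔+.refl (𝓔+.sym 𝓔+-Properties.ε⁻¹≈ε))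

  consʳ-subgroup : ∀ {p} {P : 𝓔 (suc n) → Set p} → AdditiveSubgroup P → AdditiveSubgroup (P ∘ cons 0ᴱ)
  consʳ-subgroup = AdditiveSubgroup-preimage (cons 0ᴱ)
    (λ v≈ → lo-hi-ext 𝓔+.refl v≈) (lo-hi-ext 𝓔+.refl 𝓔+.refl)
    (λ v v′ → lo-hi-ext (𝓔+.sym (𝓔+.identityʳ 0ᴱ)) 𝓔+.refl) (λ v → lo-hi-ext (𝓔+.sym 𝓔+-Properties.ε⁻¹≈ε) 𝓔+.refl)

  ∧-subgroup : ∀ {p} {P : 𝓔 n → Set p} (d : 𝓔 n) → AdditiveSubgroup P → AdditiveSubgroup (P ∘ (d ∧_))
  ∧-subgroup d = AdditiveSubgroup-preimage (d ∧_) (∧-cong 𝓔+.refl) (∧-zeroʳ d) (∧-distribˡ-+ d) (∧-negʳ d)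

  ∂e∈AdditiveSubgroup : ∀ {p} {P : 𝓔 n → Set p} → AdditiveSubgroup P →
                        ∀ A → (∀ x → x ∈ A → P (e (A - x))) → P (∂ (e A))
  ∂e∈AdditiveSubgroup {zero} P-subgroup [] _ = ≈-closed ([]-ext (sym (∂-[] (e [])))) 0-closed
    where open AdditiveSubgroup P-subgroup
  ∂e∈AdditiveSubgroup {suc n} P-subgroup (outside ∷ A) e[A-x]∈P =
    ≈-closed ∂e≈ (∂e∈AdditiveSubgroup (consˡ-subgroup P-subgroup) A λ x x∈A →
      ≈-closed (lo-hi-ext (lo-e-outside (A - x)) (hi-e-outside (A - x))) (e[A-x]∈P (Fin.suc x) (there x∈A)))
    where
    open AdditiveSubgroup P-subgroup
    ∂e≈ : cons (∂ (e A)) 0ᴱ ≈ᴱ ∂ (e (outside ∷ A))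
    ∂e≈ = lo-hi-ext (𝓔+.sym (lo-∂-e-outside A)) (𝓔+.sym (hi-∂-e-outside A))
  ∂e∈AdditiveSubgroup {suc n} {P = P} P-subgroup (inside ∷ A) e[A-x]∈P =
    ≈-closed ∂e≈ (+-closed eA∈P (neg-closed (∂e∈AdditiveSubgroup (consʳ-subgroup P-subgroup) A λ x x∈A →
      ≈-closed (lo-hi-ext (lo-e-inside (A - x)) (hi-e-inside (A - x))) (e[A-x]∈P (Fin.suc x) (there x∈A)))))
    where
    open AdditiveSubgroup P-subgroup
    eA∈P : P (cons (e A) 0ᴱ)
    eA∈P = ≈-closed (lo-hi-ext (𝓔+.trans (lo-e-outside (A ─ ⊥)) (e-cong (p─⊥≡p A))) (hi-e-outside (A ─ ⊥)))
                    (e[A-x]∈P Fin.zero here)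
    ∂e≈ : (cons (e A) 0ᴱ +ᴱ (-ᴱ cons 0ᴱ (∂ (e A)))) ≈ᴱ ∂ (e (inside ∷ A))
    ∂e≈ = lo-hi-ext
      (𝓔+.trans (+ᴱ-cong 𝓔+.refl 𝓔+-Properties.ε⁻¹≈ε) (𝓔+.trans (𝓔+.identityʳ _) (𝓔+.sym (lo-∂-e-inside A))))
      (𝓔+.trans (𝓔+.identityˡ _) (𝓔+.sym (hi-∂-e-inside A)))

  module _ {p} {𝔛 : Subset n → Set p} where

    ∂e∈Im⇒e∈Im : x ∈ X → Im 𝔛 (∂ (e X)) → Im 𝔛 (e X)
    ∂e∈Im⇒e∈Im {x = x} x∈X ∂e∈Im = resp (𝓔+.sym (e≈e⁅x⁆∧∂e x∈X)) (mulˡ (e ⁅ x ⁆) ∂e∈Im)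

    e[X-x]∈Im : 2 ≤ ∣ X ∣ → x ∈ X → (∀ y → y ∈ X → y ≢ x → Im 𝔛 (e (X - y))) → Im 𝔛 (e (X - x))
    e[X-x]∈Im {X = X} {x = x} 2≤∣X∣ x∈X e[X-y]∈Im = resp (e⁅x⁆∧-homotopy x (e (X - x))) (add ∂-term ∧-term)
      where
      eX∈Im : Im 𝔛 (e X)
      eX∈Im with (y , y∈X , y≢x) ← ∃-other-element 2≤∣X∣ x = Ideal-e y∈X (e[X-y]∈Im y y∈X y≢x)
      ∂-term : Im 𝔛 (∂ (e ⁅ x ⁆ ∧ e (X - x)))
      ∂-term = Ideal-∂[e⁅x⁆∧e[X-x]] x∈X (Im-∂ eX∈Im)
      E∧e[X-x-y]∈Im : ∀ y → y ∈ X - x → Im 𝔛 (e ⁅ x ⁆ ∧ e (X - x - y))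
      E∧e[X-x-y]∈Im y y∈X-x =
        ≡.subst (λ W → Im 𝔛 (e ⁅ x ⁆ ∧ e W)) (p─x─y≡p─y─x X y x)
          (Ideal-e⁅x⁆∧e[X-x] (x∈p∧x≢y⇒x∈p-y x∈X (y≢x ∘ ≡.sym)) (e[X-y]∈Im y y∈X y≢x))
        where
        y∈X : y ∈ X
        y∈X = p─q⊆p X ⁅ x ⁆ y∈X-x
        y≢x : y ≢ x
        y≢x = x∈p-y⇒x≢y y∈X-x
      ∧-term : Im 𝔛 (e ⁅ x ⁆ ∧ ∂ (e (X - x)))
      ∧-term = ∂e∈AdditiveSubgroup (∧-subgroup (e ⁅ x ⁆) Ideal-additiveSubgroup) (X - x) E∧e[X-x-y]∈Im

  e[XΔX′]∈Im : ∀ (X X′ : Subset n) → X ∩ X′ ≡ ⁅ x ⁆ → Im (λ Y → Y ≡ X ⊎ Y ≡ X′) (e (X Δ X′))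
  e[XΔX′]∈Im {x = x} X X′ X∩X′≡⁅x⁆ = resp eΔ≈ (Ideal-· (sgn (inv A B)) (Ideal-∧ x (e A) (e B)
    (∂[e⁅x⁆∧e]∈ X-x≡A (proj₁ x∈X∩X′) (inj₁ ≡.refl)) (∂[e⁅x⁆∧e]∈ X′-x≡B (proj₂ x∈X∩X′) (inj₂ ≡.refl))))
    where
    A B : Subset _
    A = X ─ X′
    B = X′ ─ X
    x∈X∩X′ : x ∈ X × x ∈ X′
    x∈X∩X′ = x∈p∩q⁻ X X′ (≡.subst (x ∈_) (≡.sym X∩X′≡⁅x⁆) (x∈⁅x⁆ x))
    X-x≡A : X - x ≡ A
    X-x≡A = p∩q≡⁅x⁆⇒p-x≡p─q X X′ X∩X′≡⁅x⁆
    X′-x≡B : X′ - x ≡ B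
    X′-x≡B = p∩q≡⁅x⁆⇒p-x≡p─q X′ X (≡.trans (∩-comm X′ X) X∩X′≡⁅x⁆)
    ∂[e⁅x⁆∧e]∈ : ∀ {Y W} → Y - x ≡ W → x ∈ Y → Y ≡ X ⊎ Y ≡ X′ →
                 Im (λ Y → Y ≡ X ⊎ Y ≡ X′) (∂ (e ⁅ x ⁆ ∧ e W))
    ∂[e⁅x⁆∧e]∈ {Y} ≡.refl x∈Y Y∈𝔛 = Ideal-∂[e⁅x⁆∧e[X-x]] x∈Y (gen (Y , Y∈𝔛 , ≡.refl))
    eΔ≈ : (sgn (inv A B) ·ᴱ (e A ∧ e B)) ≈ᴱ e (X Δ X′)
    eΔ≈ = 𝓔+.trans (·ᴱ-congˡ _ (e-∧-e-disjoint A B ([p─q]∩[q─p]≡⊥ X X′))) (·ᴱ-sgn-involutive (inv A B) (e (A ∪ B)))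

lemma1 : ∀ {c ℓ} (K : Field c ℓ) (n : ℕ) → 1 ≤ n →
    let open Grassmann K in
    (𝔛 : Subset n → Set) (X X′ : Subset n) → 2 ≤ ∣ X ∣ → 2 ≤ ∣ X′ ∣ →
    (iα : Fin n) → iα ∈ X →
      (Im 𝔛 (∂ (e X)) ⇔ Im 𝔛 (e X))
      × ((∀ iℓ → iℓ ∈ X → ¬ (iℓ ≡ iα) → Im 𝔛 (e (X - iℓ))) → Im 𝔛 (e (X - iα)))
      × (X ∩ X′ ≡ ⁅ iα ⁆ → Im (λ Y → Y ≡ X ⊎ Y ≡ X′) (e (X Δ X′)))
lemma1 K n _ 𝔛 X X′ 2≤∣X∣ _ iα iα∈X =
  mk⇔ (∂e∈Im⇒e∈Im iα∈X) Im-∂ , e[X-x]∈Im 2≤∣X∣ iα∈X , e[XΔX′]∈Im X X′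
  where open ExteriorAlgebra K
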